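{- Let $s\ge1$, $t\ge0$, let $C_1,\ldots,C_s$ be generating matrices of an order 2 digital $(t,s)$-sequence over $\mathbb{F}_2$, let $N\ge2$ with $N=2^{m_1}+\cdots+2^{m_r}$, $m_1>\cdots>m_r\ge0$, let $1\le h\le r$ and $\boldsymbol{b}\in\mathbb{N}_0^s$. There is a constant $C>0$ depending only on $s$ and $t$ such that: if $|\boldsymbol{b}|_1\ge m_h$ then $$\sum_{\boldsymbol{\ell}\in B(\boldsymbol{b})}\sum_{\substack{\boldsymbol{z}\in\mathbb{N}_0^s\\ \boldsymbol{\ell}\oplus\lfloor2^{\boldsymbol{z}+\nu(\boldsymbol{\ell})-\boldsymbol{1}}\rfloor\in\mathcal{D}^\ast_{m_h,s}}}2^{ -|\boldsymbol{z}|_1}\le C\,2^{|\boldsymbol{b}|_1-m_h},$$ and if $|\boldsymbol{b}|_1<m_h$ then the same double sum is at most $C\,2^{ -2m_h+2|\boldsymbol{b}|_1}\binom{2m_h-2|\boldsymbol{b}|_1+s}{s-1}$.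
   Context: Order 2 digital $(t,s)$-sequence over $\mathbb{F}_2$: generating matrices $C_j=(c_{j,k,\ell})\in\mathbb{F}_2^{\mathbb{N}\times\mathbb{N}}$ with $c_{j,k,\ell}=0$ for $k>2\ell$ such that for all $m>t/2$ the upper-left submatrices $C_j^{2m\times m}$, with rows $c_{j,1},\ldots,c_{j,2m}$, satisfy: for all $\nu_j\ge0$ and $1\le i_{j,\nu_j}<\cdots<i_{j,1}\le2m$ with $\sum_j\sum_{l=1}^{\min(\nu_j,2)}i_{j,l}\le2m-t$ the rows $c_{j,i_{j,l}}$ are linearly independent over $\mathbb{F}_2$. $\mu_1(0)=0$, $\mu_1(k)=1+\lfloor\log_2k\rfloor$ for $k\ge1$; $\nu(\boldsymbol{\ell})=(\mu_1(\ell_j))_j$; $B(\boldsymbol{b})=\{\boldsymbol{\ell}\in\mathbb{N}_0^s:\mu_1(\ell_j)=b_j\ \forall j\}$; $|\boldsymbol{v}|_1=\sum_jv_j$. $\oplus$: digitwise addition mod 2 of binary expansions of nonnegative integers; $\boldsymbol{\ell}\oplus\lfloor2^{\boldsymbol{z}+\nu(\boldsymbol{\ell})-\boldsymbol{1}}\rfloor$ has $j$th entry $\ell_j\oplus\lfloor2^{z_j+\mu_1(\ell_j)-1}\rfloor$. Dual net: for $m\ge0$ and $k\in\mathbb{N}_0$ with binary digits $\kappa_0,\kappa_1,\ldots$ let $\vec{k}=(\kappa_0,\ldots,\kappa_{2m-1})^\top\in\mathbb{F}_2^{2m}$; $\mathcal{D}_{m,s}=\{\boldsymbol{k}\in\mathbb{N}_0^s:\sum_{j=1}^s(C_j^{2m\times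 m})^\top\vec{k}_j=\vec{0}\in\mathbb{F}_2^m\}$ and $\mathcal{D}^\ast_{m,s}=\mathcal{D}_{m,s}\setminus\{\boldsymbol{0}\}$. Binomial coefficients $\binom{n}{k}$ are $0$ for $n<k$. -}

module Defs where

open import Data.Nat as ℕ using (ℕ; zero; suc; _+_; _*_; _∸_; _^_; _<_; _≤_; _≡ᵇ_; _%_; _/_)
open import Data.Nat.Logarithm using (⌊log₂_⌋)
open import Data.Bool using (Bool; true; false; _xor_; _∧_; if_then_else_)
open import Data.Fin using (Fin; zero; suc)
open import Data.List using (List; []; _∷_; foldr)
open import Data.Integer using (+_)
open import Data.Rational as ℚ using (ℚ; 0ℚ; 1ℚ; ½)
open import Data.Product using (Σ; ∃; _×_; _,_)
open import Relation.Binary.PropositionalEquality using (_≡_; _≢_)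
open import Relation.Nullary using (¬_)
open import Data.Unit using (⊤)
open import Data.Empty using (⊥)
open import Data.Sum using (_⊎_)
open import Data.Bool using (not; _∨_)

foldFin : {A : Set} → (A → A → A) → A → (s : ℕ) → (Fin s → A) → A
foldFin _⊙_ e zero    f = e
foldFin _⊙_ e (suc s) f = f zero ⊙ foldFin _⊙_ e s (λ i → f (suc i))

sumFin : (s : ℕ) → (Fin s → ℕ) → ℕ
sumFin = foldFin _+_ 0

xorFin : (s : ℕ) → (Fin s → Bool) → Bool
xorFin = foldFin _xor_ false

xorUpTo : ℕ → (ℕ → Bool) → Bool
xorUpTo zero    f = false
xorUpTo (suc n) f = xorUpTo n f xor f n

xorList : List ℕ → (ℕ → Bool) → Bool
xorList xs f = foldr (λ i acc → f i xor acc) false xs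

bit : ℕ → ℕ → Bool
bit k zero    = k % 2 ≡ᵇ 1
bit k (suc i) = bit (k / 2) i

-- xor with explicit fuel (fuel ≥ number of binary digits suffices)
xorFuel : ℕ → ℕ → ℕ → ℕ
xorFuel zero     a b = 0
xorFuel (suc f) a b =
  (if (a % 2 ≡ᵇ 1) xor (b % 2 ≡ᵇ 1) then 1 else 0) + 2 * xorFuel f (a / 2) (b / 2)

_⊕_ : ℕ → ℕ → ℕ
a ⊕ b = xorFuel (suc (a + b)) a b

μ₁ : ℕ → ℕ
μ₁ zero    = 0
μ₁ (suc k) = suc ⌊log₂ (suc k) ⌋

-- ⌊ 2^(e - 1) ⌋ for an integer exponent e - 1 with e ∈ ℕ (= 0 when e = 0)
floor2^pred : ℕ → ℕ
floor2^pred zero    = 0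
floor2^pred (suc e) = 2 ^ e

-- Generating matrices.
-- A family of generating matrices over F₂ in dimension s:
-- C j k l  (0-based k, l) is the entry c_{j,k+1,l+1} of C_{j+1}.

GenMats : ℕ → Set
GenMats s = Fin s → ℕ → ℕ → Bool

StrictDec : List ℕ → Set
StrictDec []           = ⊤
StrictDec (i ∷ [])     = i ≡ i
StrictDec (i ∷ i′ ∷ is) = (i′ < i) × StrictDec (i′ ∷ is)

-- Σ_{l=1}^{min(ν,2)} i_l  for 1-based indices (list holds 0-based ones)
topTwo : List ℕ → ℕ
topTwo []           = 0
topTwo (i ∷ [])     = suc i
topTwo (i ∷ i′ ∷ _) = suc i + suc i′

_∈L_ : ℕ → List ℕ → Set
i ∈L []       = ⊥
i ∈L (x ∷ xs) = (i ≡ x) ⊎ (i ∈L xs)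

-- The rows { c_{j,i} : j, i ∈ S j } of the matrices C_j^{2m×m} (rows truncated
-- to their first m entries) are linearly independent over F₂: every
-- nontrivial F₂-combination of them is nonzero.
RowsLinIndep : (s : ℕ) → GenMats s → ℕ → (Fin s → List ℕ) → Set
RowsLinIndep s C m S =
  (a : Fin s → ℕ → Bool) →
  (∀ j i → a j i ≡ true → i ∈L S j) →
  (Σ (Fin s) λ j → Σ ℕ λ i → a j i ≡ true) →
  Σ ℕ λ l → (l < m) ×
    (xorFin s (λ j → xorList (S j) (λ i → a j i ∧ C j i l)) ≡ true)

IsOrder2DigitalSeq : (t s : ℕ) → GenMats s → Set
IsOrder2DigitalSeq t s C =
  -- c_{j,k,l} = 0 for k > 2l  (1-based)
  (∀ j k l → 2 * suc l < suc k → C j k l ≡ false) ×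
  (∀ m → t < 2 * m →
     (S : Fin s → List ℕ) →
     (∀ j → StrictDec (S j)) →
     (∀ j i → i ∈L S j → i < 2 * m) →
     sumFin s (λ j → topTwo (S j)) + t ≤ 2 * m →
     RowsLinIndep s C m S)

-- k ∈ D_{m,s}  iff  Σ_j (C_j^{2m×m})^T k⃗_j = 0 in F₂^m, i.e. for every
-- column l < m:  Σ_j Σ_{i<2m} c_{j,i+1,l+1} κ_{j,i} = 0  (computed as a Bool)
andUpTo : ℕ → (ℕ → Bool) → Bool
andUpTo zero    f = true
andUpTo (suc n) f = andUpTo n f ∧ f n

andFin : (s : ℕ) → (Fin s → Bool) → Bool
andFin = foldFin _∧_ true

inDualᵇ : (s : ℕ) → GenMats s → ℕ → (Fin s → ℕ) → Bool
inDualᵇ s C m k =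
  andUpTo m λ l →
    not (xorFin s (λ j → xorUpTo (2 * m) (λ i → C j i l ∧ bit (k j) i)))

inDual*ᵇ : (s : ℕ) → GenMats s → ℕ → (Fin s → ℕ) → Bool
inDual*ᵇ s C m k = inDualᵇ s C m k ∧ not (andFin s (λ j → k j ≡ᵇ 0))

ℕ→ℚ : ℕ → ℚ
ℕ→ℚ n = + n ℚ./ 1

pow2inv : ℕ → ℚ
pow2inv zero    = 1ℚ
pow2inv (suc n) = ½ ℚ.* pow2inv n

sumBelowℚ : ℕ → (ℕ → ℚ) → ℚ
sumBelowℚ zero    f = 0ℚ
sumBelowℚ (suc n) f = sumBelowℚ n f ℚ.+ f n

boxSum : (s : ℕ) → (Fin s → ℕ) → ((Fin s → ℕ) → ℚ) → ℚ
boxSum zero    bd f = f (λ ())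
boxSum (suc s) bd f =
  sumBelowℚ (bd zero) λ a →
    boxSum s (λ j → bd (suc j)) (λ z → f λ { zero → a ; (suc j) → z j })

boxSumIf : (s : ℕ) → (Fin s → ℕ) → ((Fin s → ℕ) → Bool) → ((Fin s → ℕ) → ℚ) → ℚ
boxSumIf s bd P f = boxSum s bd (λ z → if P z then f z else 0ℚ)

inBᵇ : (s : ℕ) → (Fin s → ℕ) → (Fin s → ℕ) → Bool
inBᵇ s b ℓ = andFin s (λ j → μ₁ (ℓ j) ≡ᵇ b j)

shiftXor : (s : ℕ) → (Fin s → ℕ) → (Fin s → ℕ) → (Fin s → ℕ)
shiftXor s ℓ z j = ℓ j ⊕ floor2^pred (z j + μ₁ (ℓ j))

-- The double sum of the lemma, with the (infinite) z-sum truncated to the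
-- box z_j < Z.  B(b) is finite: μ₁(ℓ_j) = b_j forces ℓ_j < 2^{b_j}.
-- Since all terms are ≥ 0, bounding every truncation Z bounds the full sum.
doubleSumTrunc : (s : ℕ) → GenMats s → ℕ → (Fin s → ℕ) → ℕ → ℚ
doubleSumTrunc s C m b Z =
  boxSumIf s (λ j → 2 ^ b j) (inBᵇ s b) λ ℓ →
    boxSumIf s (λ _ → Z) (λ z → inDual*ᵇ s C m (shiftXor s ℓ z)) λ z →
      pow2inv (sumFin s z)

-- Swapping the two sums, the double sum becomes Σ_z 2^{-|z|} N(z), where N(z) counts the
-- ℓ ∈ B(b) with k = ℓ ⊕ ⌊2^{z+ν(ℓ)-1}⌋ ∈ D*. Choose a ≤ b with |a| = min(|b|, m - t). Two
-- such ℓ agreeing in all digits from a_j on differ by a dual vector supported below a, and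
-- the order 2 (t,s)-property forces such a vector to vanish, so N(z) ≤ 2^{|b| - (m - t)}.
-- Since Σ_z 2^{-|z|} ≤ 2^s this gives the bound for |b| ≥ m. If |b| < m, the digits of k_j
-- lie below b_j or at z_j + b_j - 1, and the (t,s)-property then forces |z| ≥ 2m - 2|b| - t;
-- the tail Σ_{|z| ≥ n} 2^{-|z|} ≤ 2·3^{s-1} 2^{-n} C(n+s-1, s-1) gives the second bound.

module Submission where

open import Defs
open import Data.Nat
  using ( ℕ; zero; suc; _+_; _*_; _∸_; _^_; _<_; _≤_; _≤′_; ≤′-refl; ≤′-step
        ; _≡ᵇ_; _≤ᵇ_; _<ᵇ_; z≤n; s≤s; s≤s⁻¹)
import Data.Nat.Properties as ℕ
import Data.Nat.Tactic.RingSolver as ℕ-Solver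
open import Data.Nat.DivMod
  using (_/_; _%_; m≡m%n+[m/n]*n; m%n<n; m*n%n≡0; [m+kn]%n≡m%n; m*n/n≡m; +-distrib-/; m<n*o⇒m/o<n)
open import Data.Nat.Combinatorics using (_C_; nCn≡1; nCk+nC[k+1]≡[n+1]C[k+1])
import Data.Integer as ℤ
import Data.Integer.Properties as ℤ
open import Data.Rational as ℚ using (ℚ; 0ℚ; 1ℚ; ½; toℚᵘ)
import Data.Rational.Properties as ℚ
open import Data.Rational.Unnormalised as ℚᵘ using (ℚᵘ; mkℚᵘ; *≡*)
import Data.Rational.Unnormalised.Properties as ℚᵘ
open import Data.Bool using (Bool; true; false; if_then_else_; T; _∧_; _xor_; not)
import Data.Bool.Properties as Bool
open import Data.Fin using (Fin; zero; suc)
import Data.Fin as F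
open import Data.List using (List; []; _∷_)
open import Algebra.Bundles using (CommutativeMonoid; CommutativeRing)
import Algebra.Properties.CommutativeSemigroup as CommSemigroupProperties
open import Data.Maybe using (nothing)
open import Data.Product using (Σ; _×_; _,_; proj₁; proj₂)
open import Data.Sum using (_⊎_; inj₁; inj₂)
open import Function using (_∘_; Equivalence)
open import Relation.Binary.PropositionalEquality
open import Relation.Nullary using (¬_; yes; no; contradiction)
open import Relation.Nullary.Decidable using (from-yes)
import Tactic.RingSolver.Core.AlmostCommutativeRing as ACR
open import Tactic.RingSolver using (solve-∀)
open import Level using (0ℓ)

module ℚ+ = CommSemigroupProperties (CommutativeMonoid.commutativeSemigroup ℚ.+-0-commutativeMonoid)
module ℚ* = CommSemigroupProperties (CommutativeMonoid.commutativeSemigroup ℚ.*-1-commutativeMonoid)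
module ℕ+ = CommSemigroupProperties ℕ.+-commutativeSemigroup
module ℕ* = CommSemigroupProperties ℕ.*-commutativeSemigroup
module Xor = CommSemigroupProperties (CommutativeRing.+-commutativeSemigroup Bool.xor-∧-commutativeRing)

ℚ-ring : ACR.AlmostCommutativeRing 0ℓ 0ℓ
ℚ-ring = ACR.fromCommutativeRing ℚ.+-*-commutativeRing (λ _ → nothing)

ℕ→ℚᵘ : ℕ → ℚᵘ
ℕ→ℚᵘ n = mkℚᵘ (ℤ.+ n) 0

-- ℕ→ℚ normalises ℕ→ℚᵘ; arithmetic on ℕ→ℚᵘ needs no normalisation, so ℕ→ℚ is a homomorphism.
toℚᵘ-ℕ→ℚ : ∀ n → toℚᵘ (ℕ→ℚ n) ℚᵘ.≃ ℕ→ℚᵘ n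
toℚᵘ-ℕ→ℚ n = ℚ.toℚᵘ-fromℚᵘ (ℕ→ℚᵘ n)

ℕ→ℚᵘ-+ : ∀ a b → ℕ→ℚᵘ (a + b) ℚᵘ.≃ ℕ→ℚᵘ a ℚᵘ.+ ℕ→ℚᵘ b
ℕ→ℚᵘ-+ a b = *≡* (begin
  ℤ.+ (a + b) ℤ.* ℤ.+ 1
    ≡⟨ cong (ℤ._* ℤ.+ 1) (ℤ.pos-+ a b) ⟩
  (ℤ.+ a ℤ.+ ℤ.+ b) ℤ.* ℤ.+ 1
    ≡⟨ cong (ℤ._* ℤ.+ 1) (cong₂ ℤ._+_ (ℤ.*-identityʳ (ℤ.+ a)) (ℤ.*-identityʳ (ℤ.+ b))) ⟨
  (ℤ.+ a ℤ.* ℤ.+ 1 ℤ.+ ℤ.+ b ℤ.* ℤ.+ 1) ℤ.* ℤ.+ 1 ∎)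
  where open ≡-Reasoning

ℕ→ℚ-+ : ∀ a b → ℕ→ℚ (a + b) ≡ ℕ→ℚ a ℚ.+ ℕ→ℚ b
ℕ→ℚ-+ a b = ℚ.toℚᵘ-injective (begin
  toℚᵘ (ℕ→ℚ (a + b))                      ≈⟨ toℚᵘ-ℕ→ℚ (a + b) ⟩
  ℕ→ℚᵘ (a + b)                             ≈⟨ ℕ→ℚᵘ-+ a b ⟩
  ℕ→ℚᵘ a ℚᵘ.+ ℕ→ℚᵘ b                      ≈⟨ ℚᵘ.+-cong (toℚᵘ-ℕ→ℚ a) (toℚᵘ-ℕ→ℚ b) ⟨
  toℚᵘ (ℕ→ℚ a) ℚᵘ.+ toℚᵘ (ℕ→ℚ b)          ≈⟨ ℚ.toℚᵘ-homo-+ (ℕ→ℚ a) (ℕ→ℚ b) ⟨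
  toℚᵘ (ℕ→ℚ a ℚ.+ ℕ→ℚ b)                  ∎)
  where open ℚᵘ.≃-Reasoning

ℕ→ℚ-* : ∀ a b → ℕ→ℚ (a * b) ≡ ℕ→ℚ a ℚ.* ℕ→ℚ b
ℕ→ℚ-* a b = ℚ.toℚᵘ-injective (begin
  toℚᵘ (ℕ→ℚ (a * b))                      ≈⟨ toℚᵘ-ℕ→ℚ (a * b) ⟩
  ℕ→ℚᵘ (a * b)                             ≈⟨ *≡* (cong (ℤ._* ℤ.+ 1) (ℤ.pos-* a b)) ⟩
  ℕ→ℚᵘ a ℚᵘ.* ℕ→ℚᵘ b                      ≈⟨ ℚᵘ.*-cong (toℚᵘ-ℕ→ℚ a) (toℚᵘ-ℕ→ℚ b) ⟨
  toℚᵘ (ℕ→ℚ a) ℚᵘ.* toℚᵘ (ℕ→ℚ b)          ≈⟨ ℚ.toℚᵘ-homo-* (ℕ→ℚ a) (ℕ→ℚ b) ⟨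
  toℚᵘ (ℕ→ℚ a ℚ.* ℕ→ℚ b)                  ∎)
  where open ℚᵘ.≃-Reasoning

0≤ℕ→ℚ : ∀ n → 0ℚ ℚ.≤ ℕ→ℚ n
0≤ℕ→ℚ n = ℚ.nonNegative⁻¹ _ {{ℚ.normalize-nonNeg n 1}}

0≤⇒*-monoˡ-≤ : ∀ {r p q} → 0ℚ ℚ.≤ r → p ℚ.≤ q → r ℚ.* p ℚ.≤ r ℚ.* q
0≤⇒*-monoˡ-≤ {r} 0≤r = ℚ.*-monoˡ-≤-nonNeg r {{ℚ.nonNegative 0≤r}}

0≤⇒*-monoʳ-≤ : ∀ {r p q} → 0ℚ ℚ.≤ r → p ℚ.≤ q → p ℚ.* r ℚ.≤ q ℚ.* r
0≤⇒*-monoʳ-≤ {r} 0≤r = ℚ.*-monoʳ-≤-nonNeg r {{ℚ.nonNegative 0≤r}}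

0≤⇒*-mono-≤ : ∀ {p q r s} → 0ℚ ℚ.≤ p → 0ℚ ℚ.≤ r → p ℚ.≤ q → r ℚ.≤ s → p ℚ.* r ℚ.≤ q ℚ.* s
0≤⇒*-mono-≤ 0≤p 0≤r p≤q r≤s =
  ℚ.≤-trans (0≤⇒*-monoʳ-≤ 0≤r p≤q) (0≤⇒*-monoˡ-≤ (ℚ.≤-trans 0≤p p≤q) r≤s)

0≤* : ∀ {p q} → 0ℚ ℚ.≤ p → 0ℚ ℚ.≤ q → 0ℚ ℚ.≤ p ℚ.* q
0≤* {p} 0≤p 0≤q = subst (ℚ._≤ p ℚ.* _) (ℚ.*-zeroʳ p) (0≤⇒*-monoˡ-≤ 0≤p 0≤q)

p≤p+q : ∀ {p q} → 0ℚ ℚ.≤ q → p ℚ.≤ p ℚ.+ q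
p≤p+q {p} 0≤q = subst (ℚ._≤ p ℚ.+ _) (ℚ.+-identityʳ p) (ℚ.+-monoʳ-≤ p 0≤q)

p≤q+p : ∀ {p q} → 0ℚ ℚ.≤ q → p ℚ.≤ q ℚ.+ p
p≤q+p {p} {q} 0≤q = subst (p ℚ.≤_) (ℚ.+-comm p q) (p≤p+q 0≤q)

ℕ→ℚ-mono-≤ : ∀ {a b} → a ≤ b → ℕ→ℚ a ℚ.≤ ℕ→ℚ b
ℕ→ℚ-mono-≤ {a} {b} a≤b = subst (λ x → ℕ→ℚ a ℚ.≤ ℕ→ℚ x) (ℕ.m+[n∸m]≡n a≤b)
  (subst (ℕ→ℚ a ℚ.≤_) (sym (ℕ→ℚ-+ a (b ∸ a))) (p≤p+q (0≤ℕ→ℚ (b ∸ a))))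

0≤pow2inv : ∀ n → 0ℚ ℚ.≤ pow2inv n
0≤pow2inv zero    = ℚ.nonNegative⁻¹ 1ℚ
0≤pow2inv (suc n) = 0≤* (ℚ.nonNegative⁻¹ ½) (0≤pow2inv n)

pow2inv-+ : ∀ a b → pow2inv (a + b) ≡ pow2inv a ℚ.* pow2inv b
pow2inv-+ zero    b = sym (ℚ.*-identityˡ _)
pow2inv-+ (suc a) b =
  trans (cong (½ ℚ.*_) (pow2inv-+ a b)) (sym (ℚ.*-assoc ½ (pow2inv a) (pow2inv b)))

pow2inv≤1 : ∀ n → pow2inv n ℚ.≤ 1ℚ
pow2inv≤1 zero    = ℚ.≤-refl
pow2inv≤1 (suc n) = begin
  ½ ℚ.* pow2inv n   ≤⟨ 0≤⇒*-monoˡ-≤ (ℚ.nonNegative⁻¹ ½) (pow2inv≤1 n) ⟩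
  ½ ℚ.* 1ℚ          ≤⟨ from-yes (½ ℚ.≤? 1ℚ) ⟩
  1ℚ                ∎
  where open ℚ.≤-Reasoning

pow2inv-antimono : ∀ {a b} → a ≤ b → pow2inv b ℚ.≤ pow2inv a
pow2inv-antimono {a} {b} a≤b = begin
  pow2inv b                          ≡⟨ cong pow2inv (ℕ.m+[n∸m]≡n a≤b) ⟨
  pow2inv (a + (b ∸ a))              ≡⟨ pow2inv-+ a (b ∸ a) ⟩
  pow2inv a ℚ.* pow2inv (b ∸ a)      ≤⟨ 0≤⇒*-monoˡ-≤ (0≤pow2inv a) (pow2inv≤1 (b ∸ a)) ⟩
  pow2inv a ℚ.* 1ℚ                   ≡⟨ ℚ.*-identityʳ (pow2inv a) ⟩
  pow2inv a                          ∎
  where open ℚ.≤-Reasoning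

2^n*pow2inv-n : ∀ n → ℕ→ℚ (2 ^ n) ℚ.* pow2inv n ≡ 1ℚ
2^n*pow2inv-n zero    = refl
2^n*pow2inv-n (suc n) = begin
  ℕ→ℚ (2 * 2 ^ n) ℚ.* (½ ℚ.* pow2inv n)
    ≡⟨ cong (ℚ._* (½ ℚ.* pow2inv n)) (ℕ→ℚ-* 2 (2 ^ n)) ⟩
  (ℕ→ℚ 2 ℚ.* ℕ→ℚ (2 ^ n)) ℚ.* (½ ℚ.* pow2inv n)
    ≡⟨ ℚ*.interchange (ℕ→ℚ 2) (ℕ→ℚ (2 ^ n)) ½ (pow2inv n) ⟩
  (ℕ→ℚ 2 ℚ.* ½) ℚ.* (ℕ→ℚ (2 ^ n) ℚ.* pow2inv n)
    ≡⟨ cong (1ℚ ℚ.*_) (2^n*pow2inv-n n) ⟩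
  1ℚ ℚ.* 1ℚ
    ≡⟨⟩
  1ℚ ∎
  where open ≡-Reasoning

pow2inv-≤-2^*pow2inv : ∀ {n} n₀ d → n ≤ n₀ + d → pow2inv n₀ ℚ.≤ ℕ→ℚ (2 ^ d) ℚ.* pow2inv n
pow2inv-≤-2^*pow2inv {n} n₀ d n≤ = begin
  pow2inv n₀
    ≡⟨ ℚ.*-identityʳ (pow2inv n₀) ⟨
  pow2inv n₀ ℚ.* 1ℚ
    ≡⟨ cong (pow2inv n₀ ℚ.*_) (2^n*pow2inv-n d) ⟨
  pow2inv n₀ ℚ.* (ℕ→ℚ (2 ^ d) ℚ.* pow2inv d)
    ≡⟨ ℚ*.x∙yz≈y∙xz (pow2inv n₀) (ℕ→ℚ (2 ^ d)) (pow2inv d) ⟩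
  ℕ→ℚ (2 ^ d) ℚ.* (pow2inv n₀ ℚ.* pow2inv d)
    ≡⟨ cong (ℕ→ℚ (2 ^ d) ℚ.*_) (pow2inv-+ n₀ d) ⟨
  ℕ→ℚ (2 ^ d) ℚ.* pow2inv (n₀ + d)
    ≤⟨ 0≤⇒*-monoˡ-≤ (0≤ℕ→ℚ (2 ^ d)) (pow2inv-antimono n≤) ⟩
  ℕ→ℚ (2 ^ d) ℚ.* pow2inv n ∎
  where
  open ℚ.≤-Reasoning

indicator : Bool → ℚ
indicator b = if b then 1ℚ else 0ℚ

0≤indicator : ∀ b → 0ℚ ℚ.≤ indicator b
0≤indicator true  = ℚ.nonNegative⁻¹ 1ℚ
0≤indicator false = ℚ.≤-refl

indicator-mono : ∀ {b c} → (b ≡ true → c ≡ true) → indicator b ℚ.≤ indicator c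
indicator-mono {false} {c}    _   = 0≤indicator c
indicator-mono {true}  {true} _   = ℚ.≤-refl
indicator-mono {true}  {false} b⇒c with () ← b⇒c refl

indicator-∧ : ∀ b c → indicator (b ∧ c) ≡ indicator b ℚ.* indicator c
indicator-∧ true  c = sym (ℚ.*-identityˡ (indicator c))
indicator-∧ false c = sym (ℚ.*-zeroˡ (indicator c))

if-then-0≡indicator* : ∀ b x → (if b then x else 0ℚ) ≡ indicator b ℚ.* x
if-then-0≡indicator* true  x = sym (ℚ.*-identityˡ x)
if-then-0≡indicator* false x = sym (ℚ.*-zeroˡ x)

≡true⇒T : ∀ {b} → b ≡ true → T b
≡true⇒T = Equivalence.from Bool.T-≡

T⇒≡true : ∀ {b} → T b → b ≡ true
T⇒≡true = Equivalence.to Bool.T-≡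

≡ᵇ-true⇒≡ : ∀ {x y} → (x ≡ᵇ y) ≡ true → x ≡ y
≡ᵇ-true⇒≡ {x} {y} = ℕ.≡ᵇ⇒≡ x y ∘ ≡true⇒T

≡⇒≡ᵇ-true : ∀ {x y} → x ≡ y → (x ≡ᵇ y) ≡ true
≡⇒≡ᵇ-true {x} {y} = T⇒≡true ∘ ℕ.≡⇒≡ᵇ x y

≢⇒≡ᵇ-false : ∀ {x y} → x ≢ y → (x ≡ᵇ y) ≡ false
≢⇒≡ᵇ-false x≢y = Bool.¬-not (x≢y ∘ ≡ᵇ-true⇒≡)

<ᵇ-true⇒< : ∀ {m n} → (m <ᵇ n) ≡ true → m < n
<ᵇ-true⇒< {m} {n} = ℕ.<ᵇ⇒< m n ∘ ≡true⇒T

<⇒<ᵇ-true : ∀ {m n} → m < n → (m <ᵇ n) ≡ true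
<⇒<ᵇ-true = T⇒≡true ∘ ℕ.<⇒<ᵇ

≤ᵇ-true⇒≤ : ∀ {m n} → (m ≤ᵇ n) ≡ true → m ≤ n
≤ᵇ-true⇒≤ {m} {n} = ℕ.≤ᵇ⇒≤ m n ∘ ≡true⇒T

≤⇒≤ᵇ-true : ∀ {m n} → m ≤ n → (m ≤ᵇ n) ≡ true
≤⇒≤ᵇ-true = T⇒≡true ∘ ℕ.≤⇒≤ᵇ

≰⇒≤ᵇ-false : ∀ {m n} → ¬ m ≤ n → (m ≤ᵇ n) ≡ false
≰⇒≤ᵇ-false m≰n = Bool.¬-not (m≰n ∘ ≤ᵇ-true⇒≤)

≤ᵇ-cong : ∀ {m n m′ n′} → (m ≤ n → m′ ≤ n′) → (m′ ≤ n′ → m ≤ n) → (m ≤ᵇ n) ≡ (m′ ≤ᵇ n′)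
≤ᵇ-cong {m} {n} ⇒ ⇐ with m ≤ᵇ n in e
... | true  = sym (≤⇒≤ᵇ-true (⇒ (≤ᵇ-true⇒≤ e)))
... | false = sym (≰⇒≤ᵇ-false λ le → subst T e (ℕ.≤⇒≤ᵇ (⇐ le)))

sumBelow-cong : ∀ n {f g : ℕ → ℚ} → (∀ a → a < n → f a ≡ g a) → sumBelowℚ n f ≡ sumBelowℚ n g
sumBelow-cong zero    f≗g = refl
sumBelow-cong (suc n) f≗g =
  cong₂ ℚ._+_ (sumBelow-cong n (λ a a<n → f≗g a (ℕ.m<n⇒m<1+n a<n))) (f≗g n ℕ.≤-refl)

sumBelow-mono : ∀ n {f g : ℕ → ℚ} → (∀ a → a < n → f a ℚ.≤ g a) → sumBelowℚ n f ℚ.≤ sumBelowℚ n g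
sumBelow-mono zero    f≤g = ℚ.≤-refl
sumBelow-mono (suc n) f≤g =
  ℚ.+-mono-≤ (sumBelow-mono n (λ a a<n → f≤g a (ℕ.m<n⇒m<1+n a<n))) (f≤g n ℕ.≤-refl)

sumBelow-nonNeg : ∀ n {f : ℕ → ℚ} → (∀ a → a < n → 0ℚ ℚ.≤ f a) → 0ℚ ℚ.≤ sumBelowℚ n f
sumBelow-nonNeg zero    0≤f = ℚ.≤-refl
sumBelow-nonNeg (suc n) 0≤f =
  ℚ.+-mono-≤ (sumBelow-nonNeg n (λ a a<n → 0≤f a (ℕ.m<n⇒m<1+n a<n))) (0≤f n ℕ.≤-refl)

sumBelow-zero : ∀ n {f : ℕ → ℚ} → (∀ a → a < n → f a ≡ 0ℚ) → sumBelowℚ n f ≡ 0ℚ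
sumBelow-zero zero    f≗0 = refl
sumBelow-zero (suc n) f≗0 =
  cong₂ ℚ._+_ (sumBelow-zero n (λ a a<n → f≗0 a (ℕ.m<n⇒m<1+n a<n))) (f≗0 n ℕ.≤-refl)

sumBelow-+ : ∀ n (f g : ℕ → ℚ) →
             sumBelowℚ n (λ a → f a ℚ.+ g a) ≡ sumBelowℚ n f ℚ.+ sumBelowℚ n g
sumBelow-+ zero    f g = refl
sumBelow-+ (suc n) f g = trans (cong (ℚ._+ (f n ℚ.+ g n)) (sumBelow-+ n f g))
                               (ℚ+.interchange (sumBelowℚ n f) (sumBelowℚ n g) (f n) (g n))

sumBelow-*ˡ : ∀ n c (f : ℕ → ℚ) → sumBelowℚ n (λ a → c ℚ.* f a) ≡ c ℚ.* sumBelowℚ n f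
sumBelow-*ˡ zero    c f = sym (ℚ.*-zeroʳ c)
sumBelow-*ˡ (suc n) c f = trans (cong (ℚ._+ (c ℚ.* f n)) (sumBelow-*ˡ n c f))
                                (sym (ℚ.*-distribˡ-+ c (sumBelowℚ n f) (f n)))

sumBelow-swap : ∀ n k (f : ℕ → ℕ → ℚ) →
  sumBelowℚ n (λ a → sumBelowℚ k (f a)) ≡ sumBelowℚ k (λ b → sumBelowℚ n (λ a → f a b))
sumBelow-swap zero    k f = sym (sumBelow-zero k (λ _ _ → refl))
sumBelow-swap (suc n) k f = trans (cong (ℚ._+ sumBelowℚ k (f n)) (sumBelow-swap n k f))
                                  (sym (sumBelow-+ k (λ b → sumBelowℚ n (λ a → f a b)) (f n)))

sumBelow-suc : ∀ n (f : ℕ → ℚ) → sumBelowℚ (suc n) f ≡ f 0 ℚ.+ sumBelowℚ n (f ∘ suc)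
sumBelow-suc zero    f = trans (ℚ.+-identityˡ (f 0)) (sym (ℚ.+-identityʳ (f 0)))
sumBelow-suc (suc n) f = trans (cong (ℚ._+ f (suc n)) (sumBelow-suc n f))
                               (ℚ.+-assoc (f 0) (sumBelowℚ n (f ∘ suc)) (f (suc n)))

sumBelow-split : ∀ k d (f : ℕ → ℚ) →
  sumBelowℚ (k + d) f ≡ sumBelowℚ k f ℚ.+ sumBelowℚ d (λ a → f (k + a))
sumBelow-split k zero    f = trans (cong (λ n → sumBelowℚ n f) (ℕ.+-identityʳ k))
                                   (sym (ℚ.+-identityʳ (sumBelowℚ k f)))
sumBelow-split k (suc d) f = begin
  sumBelowℚ (k + suc d) f
    ≡⟨ cong (λ n → sumBelowℚ n f) (ℕ.+-suc k d) ⟩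
  sumBelowℚ (k + d) f ℚ.+ f (k + d)
    ≡⟨ cong (ℚ._+ f (k + d)) (sumBelow-split k d f) ⟩
  (sumBelowℚ k f ℚ.+ sumBelowℚ d (λ a → f (k + a))) ℚ.+ f (k + d)
    ≡⟨ ℚ.+-assoc (sumBelowℚ k f) _ (f (k + d)) ⟩
  sumBelowℚ k f ℚ.+ (sumBelowℚ d (λ a → f (k + a)) ℚ.+ f (k + d)) ∎
  where open ≡-Reasoning

sumBelow-const : ∀ n c → sumBelowℚ n (λ _ → c) ≡ ℕ→ℚ n ℚ.* c
sumBelow-const zero    c = sym (ℚ.*-zeroˡ c)
sumBelow-const (suc n) c = begin
  sumBelowℚ n (λ _ → c) ℚ.+ c        ≡⟨ cong (ℚ._+ c) (sumBelow-const n c) ⟩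
  ℕ→ℚ n ℚ.* c ℚ.+ c                  ≡⟨ distrib (ℕ→ℚ n) c ⟩
  (ℕ→ℚ n ℚ.+ 1ℚ) ℚ.* c               ≡⟨ cong (ℚ._* c) (ℕ→ℚ-+ n 1) ⟨
  ℕ→ℚ (n + 1) ℚ.* c                  ≡⟨ cong (λ x → ℕ→ℚ x ℚ.* c) (ℕ.+-comm n 1) ⟩
  ℕ→ℚ (suc n) ℚ.* c                  ∎
  where
  open ≡-Reasoning
  distrib : ∀ x c → x ℚ.* c ℚ.+ c ≡ (x ℚ.+ 1ℚ) ℚ.* c
  distrib = solve-∀ ℚ-ring

sumBelow-≡0-or-witness : ∀ n {f : ℕ → ℚ} {Q : ℕ → Set} → (∀ a → a < n → f a ≡ 0ℚ ⊎ Q a) →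
                         sumBelowℚ n f ≡ 0ℚ ⊎ Σ ℕ (λ a → a < n × Q a)
sumBelow-≡0-or-witness zero    _    = inj₁ refl
sumBelow-≡0-or-witness (suc n) zero-or-Q
  with sumBelow-≡0-or-witness n (λ a a<n → zero-or-Q a (ℕ.m<n⇒m<1+n a<n)) | zero-or-Q n ℕ.≤-refl
... | inj₂ (a , a<n , q) | _      = inj₂ (a , ℕ.m<n⇒m<1+n a<n , q)
... | inj₁ _             | inj₂ q = inj₂ (n , ℕ.≤-refl , q)
... | inj₁ e             | inj₁ e′ = inj₁ (cong₂ ℚ._+_ e e′)

sumBelow-indicator-point : ∀ H g → g < H → sumBelowℚ H (λ y → indicator (g ≡ᵇ y)) ≡ 1ℚ
sumBelow-indicator-point zero    g ()
sumBelow-indicator-point (suc H) g g<1+H with ℕ.m<1+n⇒m<n∨m≡n g<1+H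
... | inj₁ g<H  = trans (cong (ℚ._+ indicator (g ≡ᵇ H)) (sumBelow-indicator-point H g g<H))
                        (cong (λ b → 1ℚ ℚ.+ indicator b) (≢⇒≡ᵇ-false (ℕ.<⇒≢ g<H)))
... | inj₂ refl = trans (cong (ℚ._+ indicator (g ≡ᵇ g))
                              (sumBelow-zero g (λ a a<g → cong indicator (≢⇒≡ᵇ-false (ℕ.>⇒≢ a<g)))))
                        (cong (λ b → 0ℚ ℚ.+ indicator b) (≡⇒≡ᵇ-true {g} refl))

InBox : (s : ℕ) → (Fin s → ℕ) → (Fin s → ℕ) → Set
InBox s bd z = ∀ j → z j < bd j

prodFin : (s : ℕ) → (Fin s → ℕ) → ℕ
prodFin = foldFin _*_ 1

_≐ᵇ_ : ∀ {s} → (Fin s → ℕ) → (Fin s → ℕ) → Bool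
_≐ᵇ_ {s} x y = andFin s (λ j → x j ≡ᵇ y j)

andFin-true : ∀ s {f : Fin s → Bool} → andFin s f ≡ true → ∀ j → f j ≡ true
andFin-true (suc s) {f} e j with f zero in e₀
andFin-true (suc s) {f} e zero    | true = e₀
andFin-true (suc s) {f} e (suc j) | true = andFin-true s e j

andFin-intro : ∀ s {f : Fin s → Bool} → (∀ j → f j ≡ true) → andFin s f ≡ true
andFin-intro zero    f≗true = refl
andFin-intro (suc s) f≗true = cong₂ _∧_ (f≗true zero) (andFin-intro s (f≗true ∘ suc))

≐ᵇ-true⇒≗ : ∀ {s} {x y : Fin s → ℕ} → x ≐ᵇ y ≡ true → ∀ j → x j ≡ y j
≐ᵇ-true⇒≗ {s} e j = ≡ᵇ-true⇒≡ (andFin-true s e j)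

≗⇒≐ᵇ-true : ∀ {s} {x y : Fin s → ℕ} → (∀ j → x j ≡ y j) → x ≐ᵇ y ≡ true
≗⇒≐ᵇ-true {s} x≗y = andFin-intro s (λ j → ≡⇒≡ᵇ-true (x≗y j))

boxSum-cong : ∀ s bd {f g : (Fin s → ℕ) → ℚ} → (∀ z → InBox s bd z → f z ≡ g z) →
              boxSum s bd f ≡ boxSum s bd g
boxSum-cong zero    bd f≗g = f≗g _ (λ ())
boxSum-cong (suc s) bd f≗g = sumBelow-cong (bd zero) λ a a< → boxSum-cong s (bd ∘ suc)
  λ z z∈ → f≗g _ λ { zero → a< ; (suc j) → z∈ j }

boxSum-mono : ∀ s bd {f g : (Fin s → ℕ) → ℚ} → (∀ z → InBox s bd z → f z ℚ.≤ g z) →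
              boxSum s bd f ℚ.≤ boxSum s bd g
boxSum-mono zero    bd f≤g = f≤g _ (λ ())
boxSum-mono (suc s) bd f≤g = sumBelow-mono (bd zero) λ a a< → boxSum-mono s (bd ∘ suc)
  λ z z∈ → f≤g _ λ { zero → a< ; (suc j) → z∈ j }

boxSum-nonNeg : ∀ s bd {f : (Fin s → ℕ) → ℚ} → (∀ z → InBox s bd z → 0ℚ ℚ.≤ f z) →
                0ℚ ℚ.≤ boxSum s bd f
boxSum-nonNeg zero    bd 0≤f = 0≤f _ (λ ())
boxSum-nonNeg (suc s) bd 0≤f = sumBelow-nonNeg (bd zero) λ a a< → boxSum-nonNeg s (bd ∘ suc)
  λ z z∈ → 0≤f _ λ { zero → a< ; (suc j) → z∈ j }

boxSum-zero : ∀ s bd {f : (Fin s → ℕ) → ℚ} → (∀ z → InBox s bd z → f z ≡ 0ℚ) → boxSum s bd f ≡ 0ℚ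
boxSum-zero zero    bd f≗0 = f≗0 _ (λ ())
boxSum-zero (suc s) bd f≗0 = sumBelow-zero (bd zero) λ a a< → boxSum-zero s (bd ∘ suc)
  λ z z∈ → f≗0 _ λ { zero → a< ; (suc j) → z∈ j }

boxSum-*ˡ : ∀ s bd c (f : (Fin s → ℕ) → ℚ) → boxSum s bd (λ z → c ℚ.* f z) ≡ c ℚ.* boxSum s bd f
boxSum-*ˡ zero    bd c f = refl
boxSum-*ˡ (suc s) bd c f =
  trans (sumBelow-cong (bd zero) (λ a _ → boxSum-*ˡ s (bd ∘ suc) c _)) (sumBelow-*ˡ (bd zero) c _)

boxSum-const : ∀ s bd c → boxSum s bd (λ _ → c) ≡ ℕ→ℚ (prodFin s bd) ℚ.* c
boxSum-const zero    bd c = sym (ℚ.*-identityˡ c)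
boxSum-const (suc s) bd c = begin
  sumBelowℚ (bd zero) (λ _ → boxSum s (bd ∘ suc) (λ _ → c))
    ≡⟨ sumBelow-cong (bd zero) (λ _ _ → boxSum-const s (bd ∘ suc) c) ⟩
  sumBelowℚ (bd zero) (λ _ → ℕ→ℚ (prodFin s (bd ∘ suc)) ℚ.* c) ≡⟨ sumBelow-const (bd zero) _ ⟩
  ℕ→ℚ (bd zero) ℚ.* (ℕ→ℚ (prodFin s (bd ∘ suc)) ℚ.* c)
    ≡⟨ ℚ.*-assoc (ℕ→ℚ (bd zero)) _ c ⟨
  (ℕ→ℚ (bd zero) ℚ.* ℕ→ℚ (prodFin s (bd ∘ suc))) ℚ.* c
    ≡⟨ cong (ℚ._* c) (ℕ→ℚ-* (bd zero) _) ⟨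
  ℕ→ℚ (prodFin (suc s) bd) ℚ.* c ∎
  where open ≡-Reasoning

boxSum-sumBelow-swap : ∀ s bd n (f : (Fin s → ℕ) → ℕ → ℚ) →
  boxSum s bd (λ z → sumBelowℚ n (f z)) ≡ sumBelowℚ n (λ a → boxSum s bd (λ z → f z a))
boxSum-sumBelow-swap zero    bd n f = refl
boxSum-sumBelow-swap (suc s) bd n f =
  trans (sumBelow-cong (bd zero) (λ _ _ → boxSum-sumBelow-swap s (bd ∘ suc) n _))
        (sumBelow-swap (bd zero) n _)

boxSum-swap : ∀ s bd s′ bd′ (f : (Fin s → ℕ) → (Fin s′ → ℕ) → ℚ) →
  boxSum s bd (λ z → boxSum s′ bd′ (f z)) ≡ boxSum s′ bd′ (λ w → boxSum s bd (λ z → f z w))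
boxSum-swap zero    bd s′ bd′ f = refl
boxSum-swap (suc s) bd s′ bd′ f =
  trans (sumBelow-cong (bd zero) (λ _ _ → boxSum-swap s (bd ∘ suc) s′ bd′ _))
        (sym (boxSum-sumBelow-swap s′ bd′ (bd zero) _))

boxSum-indicator-≡0-or-witness : ∀ s bd (P : (Fin s → ℕ) → Bool) →
  boxSum s bd (indicator ∘ P) ≡ 0ℚ ⊎ Σ (Fin s → ℕ) (λ z → InBox s bd z × P z ≡ true)
boxSum-indicator-≡0-or-witness zero bd P = at _
  where
  at : ∀ z → indicator (P z) ≡ 0ℚ ⊎ Σ (Fin 0 → ℕ) (λ z → InBox 0 bd z × P z ≡ true)
  at z with P z in e
  ... | false = inj₁ refl
  ... | true  = inj₂ (z , (λ ()) , e)
boxSum-indicator-≡0-or-witness (suc s) bd P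
  with sumBelow-≡0-or-witness (bd zero) (λ a _ → boxSum-indicator-≡0-or-witness s (bd ∘ suc) _)
... | inj₁ e                     = inj₁ e
... | inj₂ (a , a< , z , z∈ , p) = inj₂ (_ , (λ { zero → a< ; (suc j) → z∈ j }) , p)

boxSum-indicator-point : ∀ s bd z → InBox s bd z → boxSum s bd (λ y → indicator (z ≐ᵇ y)) ≡ 1ℚ
boxSum-indicator-point zero    bd z z∈ = refl
boxSum-indicator-point (suc s) bd z z∈ = begin
  sumBelowℚ (bd zero) (λ a → boxSum s (bd ∘ suc) (λ y → indicator ((z zero ≡ᵇ a) ∧ (z ∘ suc) ≐ᵇ y)))
    ≡⟨ sumBelow-cong (bd zero) (λ a _ → slice a) ⟩
  sumBelowℚ (bd zero) (λ a → indicator (z zero ≡ᵇ a) ℚ.* 1ℚ)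
    ≡⟨ sumBelow-cong (bd zero) (λ a _ → ℚ.*-identityʳ _) ⟩
  sumBelowℚ (bd zero) (λ a → indicator (z zero ≡ᵇ a))
    ≡⟨ sumBelow-indicator-point (bd zero) (z zero) (z∈ zero) ⟩
  1ℚ ∎
  where
  open ≡-Reasoning
  slice : ∀ a → boxSum s (bd ∘ suc) (λ y → indicator ((z zero ≡ᵇ a) ∧ (z ∘ suc) ≐ᵇ y))
                ≡ indicator (z zero ≡ᵇ a) ℚ.* 1ℚ
  slice a = begin
    boxSum s (bd ∘ suc) (λ y → indicator ((z zero ≡ᵇ a) ∧ (z ∘ suc) ≐ᵇ y))
      ≡⟨ boxSum-cong s (bd ∘ suc) (λ y _ → indicator-∧ (z zero ≡ᵇ a) ((z ∘ suc) ≐ᵇ y)) ⟩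
    boxSum s (bd ∘ suc) (λ y → indicator (z zero ≡ᵇ a) ℚ.* indicator ((z ∘ suc) ≐ᵇ y))
      ≡⟨ boxSum-*ˡ s (bd ∘ suc) (indicator (z zero ≡ᵇ a)) (λ y → indicator ((z ∘ suc) ≐ᵇ y)) ⟩
    indicator (z zero ≡ᵇ a) ℚ.* boxSum s (bd ∘ suc) (λ y → indicator ((z ∘ suc) ≐ᵇ y))
      ≡⟨ cong (indicator (z zero ≡ᵇ a) ℚ.*_) (boxSum-indicator-point s (bd ∘ suc) (z ∘ suc) (z∈ ∘ suc)) ⟩
    indicator (z zero ≡ᵇ a) ℚ.* 1ℚ ∎

boxSum-indicator-≤1 : ∀ s bd (P : (Fin s → ℕ) → Bool) →
  (∀ z z′ → InBox s bd z → InBox s bd z′ → P z ≡ true → P z′ ≡ true → ∀ j → z j ≡ z′ j) →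
  boxSum s bd (indicator ∘ P) ℚ.≤ 1ℚ
boxSum-indicator-≤1 s bd P unique with boxSum-indicator-≡0-or-witness s bd P
... | inj₁ e = ℚ.≤-trans (ℚ.≤-reflexive e) (ℚ.nonNegative⁻¹ 1ℚ)
... | inj₂ (z₀ , z₀∈ , pz₀) = begin
  boxSum s bd (indicator ∘ P)                  ≤⟨ boxSum-mono s bd (λ z z∈ → indicator-mono
                                                    λ pz → ≗⇒≐ᵇ-true (unique z₀ z z₀∈ z∈ pz₀ pz)) ⟩
  boxSum s bd (λ z → indicator (z₀ ≐ᵇ z))     ≡⟨ boxSum-indicator-point s bd z₀ z₀∈ ⟩
  1ℚ                                           ∎
  where open ℚ.≤-Reasoning

-- Double counting over the fibres of g.
boxSum-indicator-≤-image : ∀ s bd H (g : (Fin s → ℕ) → (Fin s → ℕ)) (P : (Fin s → ℕ) → Bool) →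
  (∀ z → InBox s bd z → InBox s H (g z)) →
  (∀ z z′ → InBox s bd z → InBox s bd z′ → P z ≡ true → P z′ ≡ true →
     (∀ j → g z j ≡ g z′ j) → ∀ j → z j ≡ z′ j) →
  boxSum s bd (indicator ∘ P) ℚ.≤ ℕ→ℚ (prodFin s H)
boxSum-indicator-≤-image s bd H g P g∈ injective = begin
  boxSum s bd (indicator ∘ P)
    ≡⟨ boxSum-cong s bd fibres ⟩
  boxSum s bd (λ z → boxSum s H (λ y → indicator (P z ∧ g z ≐ᵇ y)))
    ≡⟨ boxSum-swap s bd s H _ ⟩
  boxSum s H (λ y → boxSum s bd (λ z → indicator (P z ∧ g z ≐ᵇ y)))
    ≤⟨ boxSum-mono s H (λ y _ → boxSum-indicator-≤1 s bd _ (fibre-unique y)) ⟩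
  boxSum s H (λ _ → 1ℚ)
    ≡⟨ boxSum-const s H 1ℚ ⟩
  ℕ→ℚ (prodFin s H) ℚ.* 1ℚ
    ≡⟨ ℚ.*-identityʳ _ ⟩
  ℕ→ℚ (prodFin s H) ∎
  where
  open ℚ.≤-Reasoning
  fibres : ∀ z → InBox s bd z → indicator (P z) ≡ boxSum s H (λ y → indicator (P z ∧ g z ≐ᵇ y))
  fibres z z∈ = begin-equality
    indicator (P z)
      ≡⟨ ℚ.*-identityʳ _ ⟨
    indicator (P z) ℚ.* 1ℚ
      ≡⟨ cong (indicator (P z) ℚ.*_) (boxSum-indicator-point s H (g z) (g∈ z z∈)) ⟨
    indicator (P z) ℚ.* boxSum s H (λ y → indicator (g z ≐ᵇ y))
      ≡⟨ boxSum-*ˡ s H (indicator (P z)) (λ y → indicator (g z ≐ᵇ y)) ⟨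
    boxSum s H (λ y → indicator (P z) ℚ.* indicator (g z ≐ᵇ y))
      ≡⟨ boxSum-cong s H (λ y _ → indicator-∧ (P z) (g z ≐ᵇ y)) ⟨
    boxSum s H (λ y → indicator (P z ∧ g z ≐ᵇ y)) ∎
  fibre-unique : ∀ y z z′ → InBox s bd z → InBox s bd z′ →
                 (P z ∧ g z ≐ᵇ y) ≡ true → (P z′ ∧ g z′ ≐ᵇ y) ≡ true → ∀ j → z j ≡ z′ j
  fibre-unique y z z′ z∈ z′∈ q q′ with P z in pz | P z′ in pz′
  ... | true | true = injective z z′ z∈ z′∈ pz pz′
                        (λ j → trans (≐ᵇ-true⇒≗ {x = g z} q j) (sym (≐ᵇ-true⇒≗ {x = g z′} q′ j)))

-- Geometric and binomial tails

nCk≤[1+n]Ck : ∀ n k → n C k ≤ suc n C k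
nCk≤[1+n]Ck n zero    = ℕ.≤-refl
nCk≤[1+n]Ck n (suc k) = subst (n C suc k ≤_) (nCk+nC[k+1]≡[n+1]C[k+1] n k) (ℕ.m≤n+m _ _)

C-monoˡ-≤ : ∀ {n m} k → n ≤ m → n C k ≤ m C k
C-monoˡ-≤ k n≤m = go (ℕ.≤⇒≤′ n≤m)
  where
  go : ∀ {n m} → n ≤′ m → n C k ≤ m C k
  go ≤′-refl         = ℕ.≤-refl
  go (≤′-step n≤′m) = ℕ.≤-trans (go n≤′m) (nCk≤[1+n]Ck _ k)

1≤[n+k]Ck : ∀ n k → 1 ≤ (n + k) C k
1≤[n+k]Ck n k = subst (_≤ (n + k) C k) (nCn≡1 k) (C-monoˡ-≤ k (ℕ.m≤n+m k n))

sumBelow-pow2inv-≤2 : ∀ Z → sumBelowℚ Z pow2inv ℚ.≤ ℕ→ℚ 2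
sumBelow-pow2inv-≤2 Z = subst (sumBelowℚ Z pow2inv ℚ.≤_) (geometric Z) (p≤p+q (0≤* (0≤ℕ→ℚ 2) (0≤pow2inv Z)))
  where
  double-half : ∀ x → ℕ→ℚ 2 ℚ.* (½ ℚ.* x) ≡ x
  double-half x = trans (sym (ℚ.*-assoc (ℕ→ℚ 2) ½ x)) (ℚ.*-identityˡ x)
  geometric : ∀ Z → sumBelowℚ Z pow2inv ℚ.+ ℕ→ℚ 2 ℚ.* pow2inv Z ≡ ℕ→ℚ 2
  geometric zero    = refl
  geometric (suc Z) = begin
    (sumBelowℚ Z pow2inv ℚ.+ pow2inv Z) ℚ.+ ℕ→ℚ 2 ℚ.* (½ ℚ.* pow2inv Z)
      ≡⟨ cong ((sumBelowℚ Z pow2inv ℚ.+ pow2inv Z) ℚ.+_) (double-half (pow2inv Z)) ⟩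
    (sumBelowℚ Z pow2inv ℚ.+ pow2inv Z) ℚ.+ pow2inv Z
      ≡⟨ add-twice (sumBelowℚ Z pow2inv) (pow2inv Z) ⟩
    sumBelowℚ Z pow2inv ℚ.+ ℕ→ℚ 2 ℚ.* pow2inv Z
      ≡⟨ geometric Z ⟩
    ℕ→ℚ 2 ∎
    where
    open ≡-Reasoning
    add-twice : ∀ a p → (a ℚ.+ p) ℚ.+ p ≡ a ℚ.+ (1ℚ ℚ.+ 1ℚ) ℚ.* p
    add-twice = solve-∀ ℚ-ring

boxSum-pow2inv-≤2^ : ∀ s Z → boxSum s (λ _ → Z) (λ z → pow2inv (sumFin s z)) ℚ.≤ ℕ→ℚ (2 ^ s)
boxSum-pow2inv-≤2^ zero    Z = ℚ.≤-refl
boxSum-pow2inv-≤2^ (suc s) Z = begin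
  sumBelowℚ Z (λ a → boxSum s (λ _ → Z) (λ z → pow2inv (a + sumFin s z)))
    ≡⟨ sumBelow-cong Z (λ a _ → trans (boxSum-cong s (λ _ → Z) (λ z _ → pow2inv-+ a (sumFin s z)))
                                      (boxSum-*ˡ s (λ _ → Z) (pow2inv a) _)) ⟩
  sumBelowℚ Z (λ a → pow2inv a ℚ.* G)
    ≡⟨ sumBelow-cong Z (λ a _ → ℚ.*-comm (pow2inv a) G) ⟩
  sumBelowℚ Z (λ a → G ℚ.* pow2inv a)
    ≡⟨ sumBelow-*ˡ Z G pow2inv ⟩
  G ℚ.* sumBelowℚ Z pow2inv
    ≤⟨ 0≤⇒*-mono-≤ (boxSum-nonNeg s (λ _ → Z) (λ z _ → 0≤pow2inv (sumFin s z)))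
                   (sumBelow-nonNeg Z (λ a _ → 0≤pow2inv a))
                   (boxSum-pow2inv-≤2^ s Z) (sumBelow-pow2inv-≤2 Z) ⟩
  ℕ→ℚ (2 ^ s) ℚ.* ℕ→ℚ 2
    ≡⟨ ℕ→ℚ-* (2 ^ s) 2 ⟨
  ℕ→ℚ (2 ^ s * 2)
    ≡⟨ cong ℕ→ℚ (ℕ.*-comm (2 ^ s) 2) ⟩
  ℕ→ℚ (2 ^ suc s) ∎
  where
  open ℚ.≤-Reasoning
  G = boxSum s (λ _ → Z) (λ z → pow2inv (sumFin s z))

sumBelow-tail-pow2inv : ∀ n Z →
  sumBelowℚ Z (λ a → indicator (n ≤ᵇ a) ℚ.* pow2inv a) ℚ.≤ ℕ→ℚ 2 ℚ.* pow2inv n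
sumBelow-tail-pow2inv zero    Z = begin
  sumBelowℚ Z (λ a → 1ℚ ℚ.* pow2inv a)  ≡⟨ sumBelow-cong Z (λ a _ → ℚ.*-identityˡ (pow2inv a)) ⟩
  sumBelowℚ Z pow2inv                   ≤⟨ sumBelow-pow2inv-≤2 Z ⟩
  ℕ→ℚ 2                                 ≡⟨ ℚ.*-identityʳ (ℕ→ℚ 2) ⟨
  ℕ→ℚ 2 ℚ.* 1ℚ                          ∎
  where open ℚ.≤-Reasoning
sumBelow-tail-pow2inv (suc n) zero    = 0≤* (0≤ℕ→ℚ 2) (0≤pow2inv (suc n))
sumBelow-tail-pow2inv (suc n) (suc Z) = begin
  sumBelowℚ (suc Z) f
    ≡⟨ sumBelow-suc Z f ⟩
  f 0 ℚ.+ sumBelowℚ Z (f ∘ suc)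
    ≡⟨ ℚ.+-identityˡ _ ⟩
  sumBelowℚ Z (f ∘ suc)
    ≡⟨ sumBelow-cong Z (λ a _ → shift a) ⟩
  sumBelowℚ Z (λ a → ½ ℚ.* (indicator (n ≤ᵇ a) ℚ.* pow2inv a))
    ≡⟨ sumBelow-*ˡ Z ½ _ ⟩
  ½ ℚ.* sumBelowℚ Z (λ a → indicator (n ≤ᵇ a) ℚ.* pow2inv a)
    ≤⟨ 0≤⇒*-monoˡ-≤ (ℚ.nonNegative⁻¹ ½) (sumBelow-tail-pow2inv n Z) ⟩
  ½ ℚ.* (ℕ→ℚ 2 ℚ.* pow2inv n)
    ≡⟨ ℚ*.x∙yz≈y∙xz ½ (ℕ→ℚ 2) (pow2inv n) ⟩
  ℕ→ℚ 2 ℚ.* (½ ℚ.* pow2inv n) ∎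
  where
  open ℚ.≤-Reasoning
  f : ℕ → ℚ
  f a = indicator (suc n ≤ᵇ a) ℚ.* pow2inv a
  shift : ∀ a → f (suc a) ≡ ½ ℚ.* (indicator (n ≤ᵇ a) ℚ.* pow2inv a)
  shift a = trans (cong (λ b → indicator b ℚ.* (½ ℚ.* pow2inv a)) (≤ᵇ-cong {suc n} {suc a} s≤s⁻¹ s≤s))
                  (ℚ*.x∙yz≈y∙xz (indicator (n ≤ᵇ a)) ½ (pow2inv a))

hockey-stick : ∀ k n → sumBelowℚ (suc n) (λ a → ℕ→ℚ ((n ∸ a + k) C k)) ≡ ℕ→ℚ ((n + suc k) C suc k)
hockey-stick k zero    = trans (ℚ.+-identityˡ _) (cong ℕ→ℚ (trans (nCn≡1 k) (sym (nCn≡1 (suc k)))))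
hockey-stick k (suc n) = begin
  sumBelowℚ (suc (suc n)) (λ a → ℕ→ℚ ((suc n ∸ a + k) C k))
    ≡⟨ sumBelow-suc (suc n) _ ⟩
  ℕ→ℚ ((suc n + k) C k) ℚ.+ sumBelowℚ (suc n) (λ a → ℕ→ℚ ((n ∸ a + k) C k))
    ≡⟨ cong₂ (λ x y → ℕ→ℚ (x C k) ℚ.+ y) (sym (ℕ.+-suc n k)) (hockey-stick k n) ⟩
  ℕ→ℚ ((n + suc k) C k) ℚ.+ ℕ→ℚ ((n + suc k) C suc k)
    ≡⟨ ℕ→ℚ-+ ((n + suc k) C k) ((n + suc k) C suc k) ⟨
  ℕ→ℚ ((n + suc k) C k + (n + suc k) C suc k)
    ≡⟨ cong ℕ→ℚ (nCk+nC[k+1]≡[n+1]C[k+1] (n + suc k) k) ⟩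
  ℕ→ℚ ((suc n + suc k) C suc k) ∎
  where open ≡-Reasoning

-- Padding to Z + (n + 1) terms and splitting after n + 1 avoids comparing Z with n + 1.
sumBelow-≤ᵇ-truncate : ∀ n Z (g : ℕ → ℚ) → (∀ a → 0ℚ ℚ.≤ g a) →
  sumBelowℚ Z (λ a → indicator (a ≤ᵇ n) ℚ.* g a) ℚ.≤ sumBelowℚ (suc n) g
sumBelow-≤ᵇ-truncate n Z g 0≤g = begin
  sumBelowℚ Z F
    ≤⟨ p≤p+q (sumBelow-nonNeg (suc n) (λ a _ → 0≤F (Z + a))) ⟩
  sumBelowℚ Z F ℚ.+ sumBelowℚ (suc n) (λ a → F (Z + a))
    ≡⟨ sumBelow-split Z (suc n) F ⟨
  sumBelowℚ (Z + suc n) F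
    ≡⟨ cong (λ k → sumBelowℚ k F) (ℕ.+-comm Z (suc n)) ⟩
  sumBelowℚ (suc n + Z) F
    ≡⟨ sumBelow-split (suc n) Z F ⟩
  sumBelowℚ (suc n) F ℚ.+ sumBelowℚ Z (λ a → F (suc n + a))
    ≡⟨ cong₂ ℚ._+_ (sumBelow-cong (suc n) (λ a a≤n → F-below a (s≤s⁻¹ a≤n)))
                   (sumBelow-zero Z (λ a _ → F-above (suc n + a) (ℕ.<⇒≱ (s≤s (ℕ.m≤m+n n a))))) ⟩
  sumBelowℚ (suc n) g ℚ.+ 0ℚ
    ≡⟨ ℚ.+-identityʳ _ ⟩
  sumBelowℚ (suc n) g ∎
  where
  open ℚ.≤-Reasoning
  F : ℕ → ℚ
  F a = indicator (a ≤ᵇ n) ℚ.* g a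
  0≤F : ∀ a → 0ℚ ℚ.≤ F a
  0≤F a = 0≤* (0≤indicator (a ≤ᵇ n)) (0≤g a)
  F-below : ∀ a → a ≤ n → F a ≡ g a
  F-below a a≤n = trans (cong (λ b → indicator b ℚ.* g a) (≤⇒≤ᵇ-true a≤n)) (ℚ.*-identityˡ (g a))
  F-above : ∀ a → ¬ a ≤ n → F a ≡ 0ℚ
  F-above a a≰n = trans (cong (λ b → indicator b ℚ.* g a) (≰⇒≤ᵇ-false a≰n)) (ℚ.*-zeroˡ (g a))

sumBelow-binomial-tail : ∀ k n Z →
  sumBelowℚ Z (λ a → indicator (a ≤ᵇ n) ℚ.* (pow2inv n ℚ.* ℕ→ℚ ((n ∸ a + k) C k)))
    ℚ.≤ pow2inv n ℚ.* ℕ→ℚ ((n + suc k) C suc k)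
sumBelow-binomial-tail k n Z = begin
  sumBelowℚ Z (λ a → indicator (a ≤ᵇ n) ℚ.* (pow2inv n ℚ.* B a))
    ≤⟨ sumBelow-≤ᵇ-truncate n Z (λ a → pow2inv n ℚ.* B a) (λ a → 0≤* (0≤pow2inv n) (0≤ℕ→ℚ ((n ∸ a + k) C k))) ⟩
  sumBelowℚ (suc n) (λ a → pow2inv n ℚ.* B a)
    ≡⟨ sumBelow-*ˡ (suc n) (pow2inv n) B ⟩
  pow2inv n ℚ.* sumBelowℚ (suc n) B
    ≡⟨ cong (pow2inv n ℚ.*_) (hockey-stick k n) ⟩
  pow2inv n ℚ.* ℕ→ℚ ((n + suc k) C suc k) ∎
  where
  open ℚ.≤-Reasoning
  B : ℕ → ℚ
  B a = ℕ→ℚ ((n ∸ a + k) C k)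

boxTail : (s′ Z n : ℕ) → ℚ
boxTail s′ Z n = boxSum (suc s′) (λ _ → Z) λ z →
  indicator (n ≤ᵇ sumFin (suc s′) z) ℚ.* pow2inv (sumFin (suc s′) z)

boxTail-peel : ∀ s′ Z n → boxTail (suc s′) Z n ≡ sumBelowℚ Z (λ a → pow2inv a ℚ.* boxTail s′ Z (n ∸ a))
boxTail-peel s′ Z n = sumBelow-cong Z λ a _ →
  trans (boxSum-cong (suc s′) (λ _ → Z) (λ z _ → term a (sumFin (suc s′) z)))
        (boxSum-*ˡ (suc s′) (λ _ → Z) (pow2inv a) (tail (n ∸ a)))
  where
  tail : ℕ → (Fin (suc s′) → ℕ) → ℚ
  tail k z = indicator (k ≤ᵇ sumFin (suc s′) z) ℚ.* pow2inv (sumFin (suc s′) z)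
  n≤a+x⇔n∸a≤x : ∀ a x → (n ≤ᵇ a + x) ≡ (n ∸ a ≤ᵇ x)
  n≤a+x⇔n∸a≤x a x = ≤ᵇ-cong (ℕ.m≤n+o⇒m∸n≤o n a) (λ le → ℕ.≤-trans (ℕ.m≤n+m∸n n a) (ℕ.+-monoʳ-≤ a le))
  term : ∀ a x → indicator (n ≤ᵇ a + x) ℚ.* pow2inv (a + x)
               ≡ pow2inv a ℚ.* (indicator (n ∸ a ≤ᵇ x) ℚ.* pow2inv x)
  term a x = trans (cong₂ (λ b p → indicator b ℚ.* p) (n≤a+x⇔n∸a≤x a x) (pow2inv-+ a x))
                   (ℚ*.x∙yz≈y∙xz (indicator (n ∸ a ≤ᵇ x)) (pow2inv a) (pow2inv x))

-- For a ≤ n the two powers combine to 2^{-n}; for a > n only B 0 = 1 remains.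
pow2inv-split : ∀ n a (B : ℕ → ℚ) → B 0 ≡ 1ℚ → (∀ d → 0ℚ ℚ.≤ B d) →
  pow2inv a ℚ.* (pow2inv (n ∸ a) ℚ.* B (n ∸ a))
    ℚ.≤ indicator (a ≤ᵇ n) ℚ.* (pow2inv n ℚ.* B (n ∸ a)) ℚ.+ indicator (n ≤ᵇ a) ℚ.* pow2inv a
pow2inv-split n a B B0≡1 0≤B with ℕ.≤-total a n
... | inj₁ a≤n = begin
  pow2inv a ℚ.* (pow2inv (n ∸ a) ℚ.* B (n ∸ a))
    ≡⟨ ℚ.*-assoc (pow2inv a) (pow2inv (n ∸ a)) (B (n ∸ a)) ⟨
  (pow2inv a ℚ.* pow2inv (n ∸ a)) ℚ.* B (n ∸ a)
    ≡⟨ cong (ℚ._* B (n ∸ a)) (trans (sym (pow2inv-+ a (n ∸ a))) (cong pow2inv (ℕ.m+[n∸m]≡n a≤n))) ⟩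
  pow2inv n ℚ.* B (n ∸ a)
    ≡⟨ ℚ.*-identityˡ _ ⟨
  1ℚ ℚ.* (pow2inv n ℚ.* B (n ∸ a))
    ≡⟨ cong (λ b → indicator b ℚ.* (pow2inv n ℚ.* B (n ∸ a))) (≤⇒≤ᵇ-true a≤n) ⟨
  indicator (a ≤ᵇ n) ℚ.* (pow2inv n ℚ.* B (n ∸ a))
    ≤⟨ p≤p+q (0≤* (0≤indicator (n ≤ᵇ a)) (0≤pow2inv a)) ⟩
  _ ∎
  where open ℚ.≤-Reasoning
... | inj₂ n≤a = begin
  pow2inv a ℚ.* (pow2inv (n ∸ a) ℚ.* B (n ∸ a))
    ≡⟨ cong (λ d → pow2inv a ℚ.* (pow2inv d ℚ.* B d)) (ℕ.m≤n⇒m∸n≡0 n≤a) ⟩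
  pow2inv a ℚ.* (1ℚ ℚ.* B 0)
    ≡⟨ cong (λ x → pow2inv a ℚ.* (1ℚ ℚ.* x)) B0≡1 ⟩
  pow2inv a ℚ.* (1ℚ ℚ.* 1ℚ)
    ≡⟨ ℚ.*-identityʳ (pow2inv a) ⟩
  pow2inv a
    ≡⟨ ℚ.*-identityˡ _ ⟨
  1ℚ ℚ.* pow2inv a
    ≡⟨ cong (λ b → indicator b ℚ.* pow2inv a) (≤⇒≤ᵇ-true n≤a) ⟨
  indicator (n ≤ᵇ a) ℚ.* pow2inv a
    ≤⟨ p≤q+p (0≤* (0≤indicator (a ≤ᵇ n)) (0≤* (0≤pow2inv n) (0≤B (n ∸ a)))) ⟩
  _ ∎
  where open ℚ.≤-Reasoning

boxTail≤ : ∀ s′ Z n → boxTail s′ Z n ℚ.≤ ℕ→ℚ (2 * 3 ^ s′) ℚ.* (pow2inv n ℚ.* ℕ→ℚ ((n + s′) C s′))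
boxTail≤ zero Z n = begin
  sumBelowℚ Z (λ a → indicator (n ≤ᵇ a + 0) ℚ.* pow2inv (a + 0))
    ≡⟨ sumBelow-cong Z (λ a _ → cong (λ x → indicator (n ≤ᵇ x) ℚ.* pow2inv x) (ℕ.+-identityʳ a)) ⟩
  sumBelowℚ Z (λ a → indicator (n ≤ᵇ a) ℚ.* pow2inv a)
    ≤⟨ sumBelow-tail-pow2inv n Z ⟩
  ℕ→ℚ 2 ℚ.* pow2inv n
    ≡⟨ cong (ℕ→ℚ 2 ℚ.*_) (ℚ.*-identityʳ (pow2inv n)) ⟨
  ℕ→ℚ 2 ℚ.* (pow2inv n ℚ.* 1ℚ) ∎
  where open ℚ.≤-Reasoning
boxTail≤ (suc s′) Z n = begin
  boxTail (suc s′) Z n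
    ≡⟨ boxTail-peel s′ Z n ⟩
  sumBelowℚ Z (λ a → p a ℚ.* boxTail s′ Z (n ∸ a))
    ≤⟨ sumBelow-mono Z (λ a _ → 0≤⇒*-monoˡ-≤ (0≤pow2inv a) (boxTail≤ s′ Z (n ∸ a))) ⟩
  sumBelowℚ Z (λ a → p a ℚ.* (c ℚ.* (p (n ∸ a) ℚ.* B (n ∸ a))))
    ≤⟨ sumBelow-mono Z (λ a _ → ℚ.≤-trans (ℚ.≤-reflexive (ℚ*.x∙yz≈y∙xz (p a) c _))
                                           (0≤⇒*-monoˡ-≤ 0≤c (pow2inv-split n a B B0≡1 0≤B))) ⟩
  sumBelowℚ Z (λ a → c ℚ.* (below a ℚ.+ above a))
    ≡⟨ trans (sumBelow-*ˡ Z c _) (cong (c ℚ.*_) (sumBelow-+ Z below above)) ⟩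
  c ℚ.* (sumBelowℚ Z below ℚ.+ sumBelowℚ Z above)
    ≤⟨ 0≤⇒*-monoˡ-≤ 0≤c (ℚ.+-mono-≤ (sumBelow-binomial-tail s′ n Z) (sumBelow-tail-pow2inv n Z)) ⟩
  c ℚ.* (p n ℚ.* B′ ℚ.+ ℕ→ℚ 2 ℚ.* p n)
    ≤⟨ 0≤⇒*-monoˡ-≤ 0≤c (ℚ.+-monoʳ-≤ (p n ℚ.* B′) (0≤⇒*-monoˡ-≤ (0≤ℕ→ℚ 2) p≤pB′)) ⟩
  c ℚ.* (p n ℚ.* B′ ℚ.+ ℕ→ℚ 2 ℚ.* (p n ℚ.* B′))
    ≡⟨ triple c (p n ℚ.* B′) ⟩
  (ℕ→ℚ 3 ℚ.* c) ℚ.* (p n ℚ.* B′)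
    ≡⟨ cong (ℚ._* (p n ℚ.* B′)) (trans (sym (ℕ→ℚ-* 3 (2 * 3 ^ s′))) (cong ℕ→ℚ (ℕ*.x∙yz≈y∙xz 3 2 (3 ^ s′)))) ⟩
  ℕ→ℚ (2 * 3 ^ suc s′) ℚ.* (p n ℚ.* B′) ∎
  where
  open ℚ.≤-Reasoning
  p = pow2inv
  c = ℕ→ℚ (2 * 3 ^ s′)
  0≤c = 0≤ℕ→ℚ (2 * 3 ^ s′)
  B : ℕ → ℚ
  B k = ℕ→ℚ ((k + s′) C s′)
  B0≡1 : B 0 ≡ 1ℚ
  B0≡1 = cong ℕ→ℚ (nCn≡1 s′)
  0≤B : ∀ k → 0ℚ ℚ.≤ B k
  0≤B k = 0≤ℕ→ℚ ((k + s′) C s′)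
  B′ = ℕ→ℚ ((n + suc s′) C suc s′)
  below above : ℕ → ℚ
  below a = indicator (a ≤ᵇ n) ℚ.* (p n ℚ.* B (n ∸ a))
  above a = indicator (n ≤ᵇ a) ℚ.* p a
  triple : ∀ c x → c ℚ.* (x ℚ.+ (1ℚ ℚ.+ 1ℚ) ℚ.* x) ≡ ((1ℚ ℚ.+ 1ℚ ℚ.+ 1ℚ) ℚ.* c) ℚ.* x
  triple = solve-∀ ℚ-ring
  p≤pB′ : p n ℚ.≤ p n ℚ.* B′
  p≤pB′ = subst (ℚ._≤ p n ℚ.* B′) (ℚ.*-identityʳ (p n))
                (0≤⇒*-monoˡ-≤ (0≤pow2inv n) (ℕ→ℚ-mono-≤ (1≤[n+k]Ck n (suc s′))))

foldFin-cong : ∀ {A : Set} (_⊙_ : A → A → A) e s {f g : Fin s → A} →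
               (∀ j → f j ≡ g j) → foldFin _⊙_ e s f ≡ foldFin _⊙_ e s g
foldFin-cong _⊙_ e zero    f≗g = refl
foldFin-cong _⊙_ e (suc s) f≗g = cong₂ _⊙_ (f≗g zero) (foldFin-cong _⊙_ e s (f≗g ∘ suc))

sumFin-cong : ∀ s {f g : Fin s → ℕ} → (∀ j → f j ≡ g j) → sumFin s f ≡ sumFin s g
sumFin-cong = foldFin-cong _+_ 0

sumFin-mono : ∀ s {f g : Fin s → ℕ} → (∀ j → f j ≤ g j) → sumFin s f ≤ sumFin s g
sumFin-mono zero    f≤g = z≤n
sumFin-mono (suc s) f≤g = ℕ.+-mono-≤ (f≤g zero) (sumFin-mono s (f≤g ∘ suc))

sumFin-+ : ∀ s (f g : Fin s → ℕ) → sumFin s (λ j → f j + g j) ≡ sumFin s f + sumFin s g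
sumFin-+ zero    f g = refl
sumFin-+ (suc s) f g = trans (cong ((f zero + g zero) +_) (sumFin-+ s (f ∘ suc) (g ∘ suc)))
                             (ℕ+.interchange (f zero) (g zero) (sumFin s (f ∘ suc)) (sumFin s (g ∘ suc)))

sumFin-*ˡ : ∀ s k (f : Fin s → ℕ) → sumFin s (λ j → k * f j) ≡ k * sumFin s f
sumFin-*ˡ zero    k f = sym (ℕ.*-zeroʳ k)
sumFin-*ˡ (suc s) k f = trans (cong (k * f zero +_) (sumFin-*ˡ s k (f ∘ suc)))
                              (sym (ℕ.*-distribˡ-+ k (f zero) (sumFin s (f ∘ suc))))

sumFin-∸ : ∀ s (a b : Fin s → ℕ) → (∀ j → a j ≤ b j) →
           sumFin s (λ j → b j ∸ a j) ≡ sumFin s b ∸ sumFin s a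
sumFin-∸ s a b a≤b = sym (trans (cong (_∸ sumFin s a) (sym sum-split)) (ℕ.m+n∸m≡n (sumFin s a) _))
  where
  sum-split : sumFin s a + sumFin s (λ j → b j ∸ a j) ≡ sumFin s b
  sum-split = trans (sym (sumFin-+ s a (λ j → b j ∸ a j))) (sumFin-cong s (λ j → ℕ.m+[n∸m]≡n (a≤b j)))

prodFin-2^ : ∀ s (e : Fin s → ℕ) → prodFin s (λ j → 2 ^ e j) ≡ 2 ^ sumFin s e
prodFin-2^ zero    e = refl
prodFin-2^ (suc s) e = trans (cong (2 ^ e zero *_) (prodFin-2^ s (e ∘ suc)))
                             (sym (ℕ.^-distribˡ-+-* 2 (e zero) (sumFin s (e ∘ suc))))

∃-≤-with-sum : ∀ s (b : Fin s → ℕ) T → T ≤ sumFin s b →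
               Σ (Fin s → ℕ) (λ a → (∀ j → a j ≤ b j) × sumFin s a ≡ T)
∃-≤-with-sum zero    b T T≤0 = (λ ()) , (λ ()) , sym (ℕ.n≤0⇒n≡0 T≤0)
∃-≤-with-sum (suc s) b T T≤ with T ℕ.≤? b zero
... | yes T≤b₀ = let (a , a≤ , Σa) = ∃-≤-with-sum s (b ∘ suc) 0 z≤n in
    (λ { zero → T ; (suc j) → a j }) , (λ { zero → T≤b₀ ; (suc j) → a≤ j }) ,
    trans (cong (T +_) Σa) (ℕ.+-identityʳ T)
... | no  T≰b₀ =
    let (a , a≤ , Σa) = ∃-≤-with-sum s (b ∘ suc) (T ∸ b zero) (ℕ.m≤n+o⇒m∸n≤o T (b zero) T≤) in
    (λ { zero → b zero ; (suc j) → a j }) , (λ { zero → ℕ.≤-refl ; (suc j) → a≤ j }) ,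
    trans (cong (b zero +_) Σa) (ℕ.m+[n∸m]≡n (ℕ.<⇒≤ (ℕ.≰⇒> T≰b₀)))

sumFin-≥ : ∀ s (f : Fin s → ℕ) j → f j ≤ sumFin s f
sumFin-≥ (suc s) f zero    = ℕ.m≤m+n (f zero) _
sumFin-≥ (suc s) f (suc j) = ℕ.≤-trans (sumFin-≥ s (f ∘ suc) j) (ℕ.m≤n+m _ (f zero))

heavy⇒≤ : ∀ {M B t Z} → 2 * M < Z + 2 * B + t → (2 * M ∸ 2 * B) ∸ t ≤ Z
heavy⇒≤ {M} {B} {t} {Z} heavy =
  subst (_≤ Z) (sym (ℕ.∸-+-assoc (2 * M) (2 * B) t))
    (ℕ.m≤n+o⇒m∸n≤o (2 * M) (2 * B + t) (ℕ.≤-trans (ℕ.<⇒≤ heavy) (ℕ.≤-reflexive (reorder Z (2 * B) t))))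
  where
  reorder : ∀ z b t → z + b + t ≡ b + t + z
  reorder = ℕ-Solver.solve-∀

high-digit⇒≤ : ∀ {M B t z₀ b₀ Z} → 2 * M ≤ z₀ + b₀ → b₀ ≤ B → z₀ ≤ Z → (2 * M ∸ 2 * B) ∸ t ≤ Z
high-digit⇒≤ {M} {B} {t} {z₀} {b₀} {Z} 2M≤ b₀≤B z₀≤Z = begin
  (2 * M ∸ 2 * B) ∸ t     ≤⟨ ℕ.m∸n≤m (2 * M ∸ 2 * B) t ⟩
  2 * M ∸ 2 * B           ≤⟨ ℕ.∸-monoʳ-≤ (2 * M) (ℕ.≤-trans b₀≤B (ℕ.m≤n*m B 2)) ⟩
  2 * M ∸ b₀              ≤⟨ ℕ.m≤n+o⇒m∸n≤o (2 * M) b₀ (subst (2 * M ≤_) (ℕ.+-comm z₀ b₀) 2M≤) ⟩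
  z₀                      ≤⟨ z₀≤Z ⟩
  Z                       ∎
  where open ℕ.≤-Reasoning

excess-≤ : ∀ B m t → B ∸ (m ∸ t) ≤ t + (B ∸ m)
excess-≤ B m t = ℕ.m≤n+o⇒m∸n≤o B (m ∸ t) (begin
  B
    ≤⟨ ℕ.m≤n+m∸n B m ⟩
  m + (B ∸ m)
    ≤⟨ ℕ.+-monoˡ-≤ (B ∸ m) (subst (m ≤_) (ℕ.+-comm t (m ∸ t)) (ℕ.m≤n+m∸n m t)) ⟩
  (m ∸ t + t) + (B ∸ m)
    ≡⟨ ℕ.+-assoc (m ∸ t) t (B ∸ m) ⟩
  (m ∸ t) + (t + (B ∸ m)) ∎)
  where open ℕ.≤-Reasoning

excess-≤-t : ∀ {B m} t → B < m → B ∸ (m ∸ t) ≤ t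
excess-≤-t {B} {m} t B<m = ℕ.m≤n+o⇒m∸n≤o B (m ∸ t)
  (ℕ.≤-trans (ℕ.<⇒≤ B<m) (subst (m ≤_) (ℕ.+-comm t (m ∸ t)) (ℕ.m≤n+m∸n m t)))

2x+t≤2m : ∀ {x m t} → 1 ≤ x → x ≤ m ∸ t → 2 * x + t ≤ 2 * m
2x+t≤2m {x} {m} {t} 1≤x x≤m∸t = begin
  2 * x + t
    ≤⟨ ℕ.+-monoˡ-≤ t (ℕ.*-monoʳ-≤ 2 x≤m∸t) ⟩
  2 * (m ∸ t) + t
    ≤⟨ ℕ.+-monoʳ-≤ (2 * (m ∸ t)) (ℕ.m≤n*m t 2) ⟩
  2 * (m ∸ t) + 2 * t
    ≡⟨ ℕ.*-distribˡ-+ 2 (m ∸ t) t ⟨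
  2 * (m ∸ t + t)
    ≡⟨ cong (2 *_) (ℕ.m∸n+n≡m {m} {t} (ℕ.<⇒≤ (ℕ.m∸n≢0⇒n<m (ℕ.n>0⇒n≢0 (ℕ.≤-trans 1≤x x≤m∸t))))) ⟩
  2 * m ∎
  where open ℕ.≤-Reasoning

-- Binary digits

/2<⇒<*2 : ∀ {x n} → x < 2 * n → x / 2 < n
/2<⇒<*2 {x} {n} x<2n = m<n*o⇒m/o<n (subst (x <_) (ℕ.*-comm 2 n) x<2n)

<2^⇒bit≡false : ∀ i k → k < 2 ^ i → bit k i ≡ false
<2^⇒bit≡false zero    zero    _      = refl
<2^⇒bit≡false zero    (suc k) (s≤s ())
<2^⇒bit≡false (suc i) k       k<2^i  = <2^⇒bit≡false i (k / 2) (/2<⇒<*2 k<2^i)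

n<2^n : ∀ n → n < 2 ^ n
n<2^n zero    = s≤s z≤n
n<2^n (suc n) = ℕ.+-mono-≤ (ℕ.m^n>0 2 n) (ℕ.≤-trans (n<2^n n) (ℕ.m≤m+n (2 ^ n) 0))

bitValue : Bool → ℕ
bitValue c = if c then 1 else 0

bit-bitValue+2* : ∀ c X → bit (bitValue c + 2 * X) 0 ≡ c
bit-bitValue+2* false X = cong (_≡ᵇ 1) (trans (cong (_% 2) (ℕ.*-comm 2 X)) (m*n%n≡0 X 2))
bit-bitValue+2* true  X =
  cong (_≡ᵇ 1) (trans (cong (λ y → (1 + y) % 2) (ℕ.*-comm 2 X)) ([m+kn]%n≡m%n 1 X 2))

bitValue+2*/2 : ∀ c X → (bitValue c + 2 * X) / 2 ≡ X
bitValue+2*/2 false X = trans (cong (_/ 2) (ℕ.*-comm 2 X)) (m*n/n≡m X 2)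
bitValue+2*/2 true  X = begin
  (1 + 2 * X) / 2
    ≡⟨ cong (λ y → (1 + y) / 2) (ℕ.*-comm 2 X) ⟩
  (1 + X * 2) / 2
    ≡⟨ +-distrib-/ 1 (X * 2) (subst (λ r → 1 + r < 2) (sym (m*n%n≡0 X 2)) ℕ.≤-refl) ⟩
  0 + X * 2 / 2
    ≡⟨ m*n/n≡m X 2 ⟩
  X ∎
  where open ≡-Reasoning

halve-≤ : ∀ {x f} → x ≤ suc f → x / 2 ≤ f
halve-≤ {x} {f} x≤1+f = s≤s⁻¹ (/2<⇒<*2 (ℕ.≤-trans (s≤s x≤1+f) (ℕ.+-mono-≤ (s≤s z≤n) (ℕ.m≤m+n (suc f) 0))))

bit-ext : ∀ x y → (∀ i → bit x i ≡ bit y i) → x ≡ y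
bit-ext x y = go (x + y) x y (ℕ.m≤m+n x y) (ℕ.m≤n+m y x)
  where
  mod2-injective : ∀ a b → a < 2 → b < 2 → (a ≡ᵇ 1) ≡ (b ≡ᵇ 1) → a ≡ b
  mod2-injective 0 0 _ _ _ = refl
  mod2-injective 1 1 _ _ _ = refl
  mod2-injective 0 1 _ _ ()
  mod2-injective 1 0 _ _ ()
  mod2-injective (suc (suc a)) _ (s≤s (s≤s ())) _ _
  mod2-injective _ (suc (suc b)) _ (s≤s (s≤s ())) _
  go : ∀ f x y → x ≤ f → y ≤ f → (∀ i → bit x i ≡ bit y i) → x ≡ y
  go zero    .zero .zero z≤n z≤n _ = refl
  go (suc f) x y x≤ y≤ same = begin
    x                       ≡⟨ m≡m%n+[m/n]*n x 2 ⟩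
    x % 2 + (x / 2) * 2     ≡⟨ cong₂ (λ r q → r + q * 2)
                                 (mod2-injective (x % 2) (y % 2) (m%n<n x 2) (m%n<n y 2) (same 0))
                                 (go f (x / 2) (y / 2) (halve-≤ x≤) (halve-≤ y≤) (same ∘ suc)) ⟩
    y % 2 + (y / 2) * 2     ≡⟨ m≡m%n+[m/n]*n y 2 ⟨
    y                       ∎
    where open ≡-Reasoning

-- xorFuel f builds its result digit by digit, so its digits are correct below the fuel.
bit-xorFuel : ∀ f a b i → i < f → bit (xorFuel f a b) i ≡ bit a i xor bit b i
bit-xorFuel (suc f) a b zero    _   = bit-bitValue+2* (bit a 0 xor bit b 0) (xorFuel f (a / 2) (b / 2))
bit-xorFuel (suc f) a b (suc i) i<f =
  trans (cong (λ y → bit y i) (bitValue+2*/2 (bit a 0 xor bit b 0) (xorFuel f (a / 2) (b / 2))))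
        (bit-xorFuel f (a / 2) (b / 2) i (s≤s⁻¹ i<f))

xorFuel<2^ : ∀ f a b → xorFuel f a b < 2 ^ f
xorFuel<2^ zero    a b = s≤s z≤n
xorFuel<2^ (suc f) a b = begin-strict
  bitValue c + 2 * X    ≤⟨ ℕ.+-monoˡ-≤ (2 * X) (bitValue≤1 c) ⟩
  1 + 2 * X             <⟨ ℕ.n<1+n (1 + 2 * X) ⟩
  2 + 2 * X             ≡⟨ ℕ.*-distribˡ-+ 2 1 X ⟨
  2 * suc X             ≤⟨ ℕ.*-monoʳ-≤ 2 (xorFuel<2^ f (a / 2) (b / 2)) ⟩
  2 * 2 ^ f             ∎
  where
  open ℕ.≤-Reasoning
  c = bit a 0 xor bit b 0
  X = xorFuel f (a / 2) (b / 2)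
  bitValue≤1 : ∀ c → bitValue c ≤ 1
  bitValue≤1 false = z≤n
  bitValue≤1 true  = ℕ.≤-refl

bit-⊕ : ∀ a b i → bit (a ⊕ b) i ≡ bit a i xor bit b i
bit-⊕ a b i with i ℕ.<? suc (a + b)
... | yes i<f = bit-xorFuel (suc (a + b)) a b i i<f
... | no  i≮f = begin
  bit (a ⊕ b) i
    ≡⟨ <2^⇒bit≡false i (a ⊕ b) (ℕ.<-≤-trans (xorFuel<2^ (suc (a + b)) a b) f≤i) ⟩
  false
    ≡⟨ cong₂ _xor_ (<2^⇒bit≡false i a (below (ℕ.m≤m+n a b))) (<2^⇒bit≡false i b (below (ℕ.m≤n+m b a))) ⟨
  bit a i xor bit b i ∎
  where
  open ≡-Reasoning
  f≤i : 2 ^ suc (a + b) ≤ 2 ^ i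
  f≤i = ℕ.^-monoʳ-≤ 2 (ℕ.≮⇒≥ i≮f)
  below : ∀ {x} → x ≤ a + b → x < 2 ^ i
  below x≤ = ℕ.<-≤-trans (ℕ.≤-<-trans x≤ (ℕ.<-trans (ℕ.n<1+n (a + b)) (n<2^n (suc (a + b))))) f≤i

bit-2^ : ∀ e i → bit (2 ^ e) i ≡ true → i ≡ e
bit-2^ zero    zero    _ = refl
bit-2^ zero    (suc i) b = contradiction (trans (sym b) (<2^⇒bit≡false (suc i) 1 1<2^[1+i])) λ ()
  where
  1<2^[1+i] : 1 < 2 ^ suc i
  1<2^[1+i] = ℕ.^-monoʳ-< 2 ℕ.≤-refl {0} {suc i} (s≤s z≤n)
bit-2^ (suc e) zero    b = contradiction (trans (sym b) (bit-bitValue+2* false (2 ^ e))) λ ()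
bit-2^ (suc e) (suc i) b =
  cong suc (bit-2^ e i (subst (λ y → bit y i ≡ true) (bitValue+2*/2 false (2 ^ e)) b))

bit-floor2^pred : ∀ e i → bit (floor2^pred e) i ≡ true → suc i ≡ e
bit-floor2^pred zero    i b = contradiction (trans (sym b) (<2^⇒bit≡false i 0 (ℕ.m^n>0 2 i))) λ ()
bit-floor2^pred (suc e) i b = cong suc (bit-2^ e i b)

even∧/2≡0⇒≡0 : ∀ x → bit x 0 ≡ false → x / 2 ≡ 0 → x ≡ 0
even∧/2≡0⇒≡0 x even x/2≡0 = trans (m≡m%n+[m/n]*n x 2) (cong₂ (λ r q → r + q * 2) (x%2≡0 even) x/2≡0)
  where
  x%2≡0 : bit x 0 ≡ false → x % 2 ≡ 0
  x%2≡0 b with x % 2 | m%n<n x 2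
  ... | 0           | _             = refl
  ... | 1           | _             = contradiction b λ ()
  ... | suc (suc _) | s≤s (s≤s ())

≢0⇒∃bit : ∀ x → x ≢ 0 → Σ ℕ (λ i → bit x i ≡ true)
≢0⇒∃bit x = go x x ℕ.≤-refl
  where
  go : ∀ f x → x ≤ f → x ≢ 0 → Σ ℕ (λ i → bit x i ≡ true)
  go f x x≤f x≢0 with bit x 0 in odd
  ... | true  = 0 , odd
  go zero    x z≤n x≢0 | false = contradiction refl x≢0
  go (suc f) x x≤f x≢0 | false with go f (x / 2) (halve-≤ x≤f) (x≢0 ∘ even∧/2≡0⇒≡0 x odd)
  ... | i , b = suc i , b

shiftʳ : ℕ → ℕ → ℕ
shiftʳ zero    x = x
shiftʳ (suc a) x = shiftʳ a (x / 2)

bit-shiftʳ : ∀ a x i → bit (shiftʳ a x) i ≡ bit x (a + i)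
bit-shiftʳ zero    x i = refl
bit-shiftʳ (suc a) x i = bit-shiftʳ a (x / 2) i

shiftʳ-< : ∀ a c x → x < 2 ^ (a + c) → shiftʳ a x < 2 ^ c
shiftʳ-< zero    c x x< = x<
shiftʳ-< (suc a) c x x< = shiftʳ-< a c (x / 2) (/2<⇒<*2 x<)

-- The dual net

xor≡false⇒≡ : ∀ {x y} → x xor y ≡ false → x ≡ y
xor≡false⇒≡ {false} {false} _ = refl
xor≡false⇒≡ {true}  {true}  _ = refl

xor-cancelʳ : ∀ x y c → (x xor c) xor (y xor c) ≡ x xor y
xor-cancelʳ x y c = begin
  (x xor c) xor (y xor c)   ≡⟨ Xor.interchange x c y c ⟩
  (x xor y) xor (c xor c)   ≡⟨ cong ((x xor y) xor_) (Bool.xor-same c) ⟩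
  (x xor y) xor false       ≡⟨ Bool.xor-identityʳ (x xor y) ⟩
  x xor y                   ∎
  where open ≡-Reasoning

xorUpTo-cong : ∀ n {f g : ℕ → Bool} → (∀ i → i < n → f i ≡ g i) → xorUpTo n f ≡ xorUpTo n g
xorUpTo-cong zero    f≗g = refl
xorUpTo-cong (suc n) f≗g =
  cong₂ _xor_ (xorUpTo-cong n (λ i i<n → f≗g i (ℕ.m<n⇒m<1+n i<n))) (f≗g n ℕ.≤-refl)

xorUpTo-xor : ∀ n (f g : ℕ → Bool) → xorUpTo n (λ i → f i xor g i) ≡ xorUpTo n f xor xorUpTo n g
xorUpTo-xor zero    f g = refl
xorUpTo-xor (suc n) f g = trans (cong (_xor (f n xor g n)) (xorUpTo-xor n f g))
                                (Xor.interchange (xorUpTo n f) (xorUpTo n g) (f n) (g n))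

xorFin-xor : ∀ s (f g : Fin s → Bool) → xorFin s (λ j → f j xor g j) ≡ xorFin s f xor xorFin s g
xorFin-xor zero    f g = refl
xorFin-xor (suc s) f g = trans (cong ((f zero xor g zero) xor_) (xorFin-xor s (f ∘ suc) (g ∘ suc)))
                               (Xor.interchange (f zero) (g zero) (xorFin s (f ∘ suc)) (xorFin s (g ∘ suc)))

-- The l-th coordinate of Σ_j (C_j^{2m×m})ᵀ β_j, for digit vectors β_j.
dualForm : (s : ℕ) → GenMats s → ℕ → (Fin s → ℕ → Bool) → ℕ → Bool
dualForm s Cs m β l = xorFin s (λ j → xorUpTo (2 * m) (λ i → Cs j i l ∧ β j i))

dualForm-xor : ∀ s Cs m β γ l →
  dualForm s Cs m (λ j i → β j i xor γ j i) l ≡ dualForm s Cs m β l xor dualForm s Cs m γ l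
dualForm-xor s Cs m β γ l = trans
  (foldFin-cong _xor_ false s λ j →
     trans (xorUpTo-cong (2 * m) (λ i _ → Bool.∧-distribˡ-xor (Cs j i l) (β j i) (γ j i)))
           (xorUpTo-xor (2 * m) _ _))
  (xorFin-xor s _ _)

andUpTo-true : ∀ n {f : ℕ → Bool} → andUpTo n f ≡ true → ∀ l → l < n → f l ≡ true
andUpTo-true (suc n) {f} e l l<1+n with andUpTo n f in e₁ | f n in e₂
... | true | true with ℕ.m<1+n⇒m<n∨m≡n l<1+n
...   | inj₁ l<n  = andUpTo-true n e₁ l l<n
...   | inj₂ refl = e₂

inDual⇒dualForm≡false : ∀ s Cs m k → inDualᵇ s Cs m k ≡ true →
                        ∀ l → l < m → dualForm s Cs m (λ j → bit (k j)) l ≡ false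
inDual⇒dualForm≡false s Cs m k e l l<m = Bool.not-injective (andUpTo-true m e l l<m)

inDual*⇒inDual : ∀ s Cs m k → inDual*ᵇ s Cs m k ≡ true → inDualᵇ s Cs m k ≡ true
inDual*⇒inDual s Cs m k = Bool.∧-conicalˡ (inDualᵇ s Cs m k) _

inDual*⇒≢0 : ∀ s Cs m k → inDual*ᵇ s Cs m k ≡ true → Σ (Fin s) (λ j → k j ≢ 0)
inDual*⇒≢0 s Cs m k e =
  some-nonzero s (Bool.not-injective (Bool.∧-conicalʳ (inDualᵇ s Cs m k) _ e))
  where
  some-nonzero : ∀ s {k : Fin s → ℕ} → andFin s (λ j → k j ≡ᵇ 0) ≡ false → Σ (Fin s) (λ j → k j ≢ 0)
  some-nonzero (suc s) {k} e with k zero ≡ᵇ 0 in e₀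
  ... | false = zero , λ k₀≡0 → contradiction (trans (sym e₀) (≡⇒≡ᵇ-true k₀≡0)) λ ()
  ... | true  = let (j , k≢0) = some-nonzero s {k ∘ suc} e in suc j , k≢0

-- Listed in decreasing order, as StrictDec and topTwo expect.
support : ℕ → (ℕ → Bool) → List ℕ
support zero    β = []
support (suc n) β = if β n then n ∷ support n β else support n β

∈-support⁻ : ∀ n β i → i ∈L support n β → i < n × β i ≡ true
∈-support⁻ (suc n) β i i∈ with β n in e
∈-support⁻ (suc n) β i (inj₁ refl) | true = ℕ.≤-refl , e
∈-support⁻ (suc n) β i (inj₂ i∈)   | true = let (i<n , b) = ∈-support⁻ n β i i∈ in ℕ.m<n⇒m<1+n i<n , b
∈-support⁻ (suc n) β i i∈          | false = let (i<n , b) = ∈-support⁻ n β i i∈ in ℕ.m<n⇒m<1+n i<n , b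

∈-support⁺ : ∀ n β i → i < n → β i ≡ true → i ∈L support n β
∈-support⁺ (suc n) β i i<1+n b with β n in e | ℕ.m<1+n⇒m<n∨m≡n i<1+n
... | true  | inj₂ refl = inj₁ refl
... | true  | inj₁ i<n  = inj₂ (∈-support⁺ n β i i<n b)
... | false | inj₁ i<n  = ∈-support⁺ n β i i<n b
... | false | inj₂ refl = contradiction (trans (sym b) e) λ ()

support-strictDec : ∀ n β → StrictDec (support n β)
support-strictDec zero    β = _
support-strictDec (suc n) β with β n
... | false = support-strictDec n β
... | true  = cons (support n β) (support-strictDec n β) (λ i i∈ → proj₁ (∈-support⁻ n β i i∈))
  where
  cons : ∀ L → StrictDec L → (∀ i → i ∈L L → i < n) → StrictDec (n ∷ L)
  cons []      _  _    = refl
  cons (x ∷ L) sd L<n = L<n x (inj₁ refl) , sd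

xorList-support : ∀ n β g → xorList (support n β) g ≡ xorUpTo n (λ i → β i ∧ g i)
xorList-support zero    β g = refl
xorList-support (suc n) β g with β n
... | true  = trans (Bool.xor-comm (g n) _) (cong (_xor g n) (xorList-support n β g))
... | false = trans (xorList-support n β g) (sym (Bool.xor-identityʳ _))

topTwo-pos : ∀ L i → i ∈L L → 1 ≤ topTwo L
topTwo-pos (x ∷ [])     i _ = s≤s z≤n
topTwo-pos (x ∷ y ∷ L)  i _ = s≤s z≤n

topTwo-≤-twice : ∀ L a → StrictDec L → (∀ i → i ∈L L → i < a) → topTwo L ≤ 2 * a
topTwo-≤-twice []          a _         _   = z≤n
topTwo-≤-twice (x ∷ [])    a _         L<a = ℕ.≤-trans (L<a x (inj₁ refl)) (ℕ.m≤m+n a (a + 0))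
topTwo-≤-twice (x ∷ y ∷ L) a (y<x , _) L<a =
  ℕ.+-mono-≤ x<a (subst (suc y ≤_) (sym (ℕ.+-identityʳ a)) (ℕ.<-trans y<x x<a))
  where x<a = L<a x (inj₁ refl)

topTwo-≤-one-outlier : ∀ L p q → StrictDec L → (∀ i → i ∈L L → i < p ⊎ suc i ≡ q) → p ≤ q →
                       topTwo L ≤ q + p
topTwo-≤-one-outlier []          p q _         _  _   = z≤n
topTwo-≤-one-outlier (x ∷ [])    p q _         L∈ p≤q with L∈ x (inj₁ refl)
... | inj₁ x<p  = ℕ.≤-trans x<p (ℕ.m≤n+m p q)
... | inj₂ refl = ℕ.m≤m+n (suc x) p
topTwo-≤-one-outlier (x ∷ y ∷ L) p q (y<x , _) L∈ p≤q with L∈ x (inj₁ refl) | L∈ y (inj₂ (inj₁ refl))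
... | inj₂ refl | inj₁ y<p  = ℕ.+-monoʳ-≤ (suc x) y<p
... | inj₂ refl | inj₂ 1+y≡1+x = contradiction (ℕ.suc-injective 1+y≡1+x) (ℕ.<⇒≢ y<x)
... | inj₁ x<p  | _         = subst (_≤ q + p) (ℕ.+-comm (suc y) (suc x))
                                (ℕ.+-mono-≤ (ℕ.≤-trans (ℕ.<-trans y<x x<p) p≤q) x<p)

-- The sum Σ_j Σ_{l ≤ min(ν_j,2)} i_{j,l} of the (t,s)-property, for the digits i < 2m set in β.
dualWeight : (s m : ℕ) → (Fin s → ℕ → Bool) → ℕ
dualWeight s m β = sumFin s (λ j → topTwo (support (2 * m) (β j)))

-- Contrapositive of the linear independence in IsOrder2DigitalSeq.
2m<dualWeight+t : ∀ {t s Cs} → IsOrder2DigitalSeq t s Cs → ∀ m (β : Fin s → ℕ → Bool) j₀ i₀ →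
  i₀ < 2 * m → β j₀ i₀ ≡ true → (∀ l → l < m → dualForm s Cs m β l ≡ false) →
  2 * m < dualWeight s m β + t
2m<dualWeight+t {t} {s} {Cs} (_ , independent) m β j₀ i₀ i₀<2m βi₀ orthogonal = ℕ.≰⇒> light⇒⊥
  where
  S : Fin s → List ℕ
  S j = support (2 * m) (β j)
  -- The coefficients must be supported on S, which only sees the digits below 2m.
  a : Fin s → ℕ → Bool
  a j i = β j i ∧ (i <ᵇ 2 * m)
  a⊆S : ∀ j i → a j i ≡ true → i ∈L S j
  a⊆S j i e =
    ∈-support⁺ (2 * m) (β j) i (<ᵇ-true⇒< (Bool.∧-conicalʳ (β j i) _ e)) (Bool.∧-conicalˡ (β j i) _ e)
  combination≡dualForm : ∀ l → xorFin s (λ j → xorList (S j) (λ i → a j i ∧ Cs j i l)) ≡ dualForm s Cs m β l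
  combination≡dualForm l = foldFin-cong _xor_ false s λ j →
    trans (xorList-support (2 * m) (β j) _)
          (xorUpTo-cong (2 * m) (λ i i<2m → select (β j i) (Cs j i l) (<⇒<ᵇ-true i<2m)))
    where
    select : ∀ b c {d} → d ≡ true → (b ∧ ((b ∧ d) ∧ c)) ≡ (c ∧ b)
    select true  c refl = sym (Bool.∧-identityʳ c)
    select false c refl = sym (Bool.∧-zeroʳ c)
  light⇒⊥ : ¬ (dualWeight s m β + t ≤ 2 * m)
  light⇒⊥ w+t≤2m =
    contradiction (trans (sym (orthogonal l l<m)) (trans (sym (combination≡dualForm l)) nonzero)) λ ()
    where
    1≤w : 1 ≤ dualWeight s m β
    1≤w = ℕ.≤-trans (topTwo-pos (S j₀) i₀ (∈-support⁺ (2 * m) (β j₀) i₀ i₀<2m βi₀))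
                    (sumFin-≥ s (topTwo ∘ S) j₀)
    t<2m : t < 2 * m
    t<2m = ℕ.<-≤-trans (ℕ.m<n+m t 1≤w) w+t≤2m
    witness = independent m t<2m S (λ j → support-strictDec (2 * m) (β j))
                (λ j i i∈ → proj₁ (∈-support⁻ (2 * m) (β j) i i∈)) w+t≤2m a a⊆S
                (j₀ , i₀ , cong₂ _∧_ βi₀ (<⇒<ᵇ-true i₀<2m))
    l = proj₁ witness
    l<m = proj₁ (proj₂ witness)
    nonzero = proj₂ (proj₂ witness)

light-dual≡0 : ∀ {t s Cs} → IsOrder2DigitalSeq t s Cs → ∀ m (a : Fin s → ℕ) → sumFin s a ≤ m ∸ t →
  (β : Fin s → ℕ → Bool) → (∀ j i → β j i ≡ true → i < a j) →
  (∀ l → l < m → dualForm s Cs m β l ≡ false) → ∀ j i → β j i ≡ false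
light-dual≡0 {t} {s} seq m a |a|≤m∸t β β-low orthogonal j i with β j i in e
... | false = refl
... | true  = contradiction (2m<dualWeight+t seq m β j i i<2m e orthogonal) (ℕ.≤⇒≯ light)
  where
  i<a = β-low j i e
  1≤|a| : 1 ≤ sumFin s a
  1≤|a| = ℕ.≤-trans (ℕ.≤-trans (s≤s z≤n) i<a) (sumFin-≥ s a j)
  i<2m : i < 2 * m
  i<2m = ℕ.<-≤-trans i<a (ℕ.≤-trans (sumFin-≥ s a j)
                           (ℕ.≤-trans |a|≤m∸t (ℕ.≤-trans (ℕ.m∸n≤m m t) (ℕ.m≤n*m m 2))))
  light : dualWeight s m β + t ≤ 2 * m
  light = begin
    dualWeight s m β + t
      ≤⟨ ℕ.+-monoˡ-≤ t (sumFin-mono s λ j → topTwo-≤-twice _ (a j) (support-strictDec (2 * m) (β j))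
                                              (λ i i∈ → β-low j i (proj₂ (∈-support⁻ (2 * m) (β j) i i∈)))) ⟩
    sumFin s (λ j → 2 * a j) + t
      ≡⟨ cong (_+ t) (sumFin-*ˡ s 2 a) ⟩
    2 * sumFin s a + t
      ≤⟨ 2x+t≤2m 1≤|a| |a|≤m∸t ⟩
    2 * m ∎
    where open ℕ.≤-Reasoning

-- The double sum

module _ {t s} {Cs : GenMats s} (seq : IsOrder2DigitalSeq t s Cs) (m : ℕ) (b : Fin s → ℕ) where

  Bbox : Fin s → ℕ
  Bbox j = 2 ^ b j

  Admissible : (Fin s → ℕ) → (Fin s → ℕ) → Bool
  Admissible z ℓ = inBᵇ s b ℓ ∧ inDual*ᵇ s Cs m (shiftXor s ℓ z)

  admissibleCount : (Fin s → ℕ) → ℚ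
  admissibleCount z = boxSum s Bbox (indicator ∘ Admissible z)

  admissible⇒inB : ∀ z ℓ → Admissible z ℓ ≡ true → ∀ j → μ₁ (ℓ j) ≡ b j
  admissible⇒inB z ℓ e j = ≡ᵇ-true⇒≡ (andFin-true s (Bool.∧-conicalˡ (inBᵇ s b ℓ) _ e) j)

  admissible⇒inDual* : ∀ z ℓ → Admissible z ℓ ≡ true → inDual*ᵇ s Cs m (shiftXor s ℓ z) ≡ true
  admissible⇒inDual* z ℓ = Bool.∧-conicalʳ (inBᵇ s b ℓ) _

  bit-shiftXor : ∀ z ℓ → Admissible z ℓ ≡ true → ∀ j i →
    bit (shiftXor s ℓ z j) i ≡ bit (ℓ j) i xor bit (floor2^pred (z j + b j)) i
  bit-shiftXor z ℓ e j i = trans (bit-⊕ (ℓ j) (floor2^pred (z j + μ₁ (ℓ j))) i)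
    (cong (λ u → bit (ℓ j) i xor bit (floor2^pred (z j + u)) i) (admissible⇒inB z ℓ e j))

  -- ℓ ⊕ ℓ′ = k ⊕ k′ is a dual vector, supported below a when ℓ and ℓ′ agree from a on.
  admissible-unique : (a : Fin s → ℕ) → sumFin s a ≤ m ∸ t →
    ∀ z ℓ ℓ′ → Admissible z ℓ ≡ true → Admissible z ℓ′ ≡ true →
    (∀ j → shiftʳ (a j) (ℓ j) ≡ shiftʳ (a j) (ℓ′ j)) → ∀ j → ℓ j ≡ ℓ′ j
  admissible-unique a |a|≤m∸t z ℓ ℓ′ adm adm′ same-high j =
    bit-ext (ℓ j) (ℓ′ j) λ i →
      xor≡false⇒≡ (trans (sym (β≡ j i)) (light-dual≡0 seq m a |a|≤m∸t β β-low β-orthogonal j i))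
    where
    k = shiftXor s ℓ z
    k′ = shiftXor s ℓ′ z
    β : Fin s → ℕ → Bool
    β j i = bit (k j) i xor bit (k′ j) i
    β≡ : ∀ j i → β j i ≡ bit (ℓ j) i xor bit (ℓ′ j) i
    β≡ j i = trans (cong₂ _xor_ (bit-shiftXor z ℓ adm j i) (bit-shiftXor z ℓ′ adm′ j i))
                   (xor-cancelʳ (bit (ℓ j) i) (bit (ℓ′ j) i) _)
    β-low : ∀ j i → β j i ≡ true → i < a j
    β-low j i e with i ℕ.<? a j
    ... | yes i<a = i<a
    ... | no  i≮a = contradiction (trans (sym e) high≡false) λ ()
      where
      high : ∀ x → bit (shiftʳ (a j) x) (i ∸ a j) ≡ bit x i
      high x = trans (bit-shiftʳ (a j) x (i ∸ a j)) (cong (bit x) (ℕ.m+[n∸m]≡n (ℕ.≮⇒≥ i≮a)))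
      high≡false : β j i ≡ false
      high≡false = begin
        β j i
          ≡⟨ β≡ j i ⟩
        bit (ℓ j) i xor bit (ℓ′ j) i
          ≡⟨ cong₂ _xor_ (high (ℓ j)) (high (ℓ′ j)) ⟨
        bit (shiftʳ (a j) (ℓ j)) (i ∸ a j) xor bit (shiftʳ (a j) (ℓ′ j)) (i ∸ a j)
          ≡⟨ cong (λ y → bit (shiftʳ (a j) (ℓ j)) (i ∸ a j) xor bit y (i ∸ a j)) (same-high j) ⟨
        bit (shiftʳ (a j) (ℓ j)) (i ∸ a j) xor bit (shiftʳ (a j) (ℓ j)) (i ∸ a j)
          ≡⟨ Bool.xor-same (bit (shiftʳ (a j) (ℓ j)) (i ∸ a j)) ⟩
        false ∎
        where open ≡-Reasoning
    β-orthogonal : ∀ l → l < m → dualForm s Cs m β l ≡ false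
    β-orthogonal l l<m =
      trans (dualForm-xor s Cs m _ _ l) (cong₂ _xor_ (orthogonal ℓ adm) (orthogonal ℓ′ adm′))
      where
      orthogonal : ∀ ℓ → Admissible z ℓ ≡ true → dualForm s Cs m (λ j → bit (shiftXor s ℓ z j)) l ≡ false
      orthogonal ℓ adm = inDual⇒dualForm≡false s Cs m (shiftXor s ℓ z)
                           (inDual*⇒inDual s Cs m _ (admissible⇒inDual* z ℓ adm)) l l<m
  admissible-count-≤ : (a : Fin s → ℕ) → (∀ j → a j ≤ b j) → sumFin s a ≤ m ∸ t → ∀ z →
    admissibleCount z ℚ.≤ ℕ→ℚ (2 ^ (sumFin s b ∸ sumFin s a))
  admissible-count-≤ a a≤b |a|≤m∸t z =
    subst (λ e → admissibleCount z ℚ.≤ ℕ→ℚ e)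
          (trans (prodFin-2^ s (λ j → b j ∸ a j)) (cong (2 ^_) (sumFin-∸ s a b a≤b)))
          (boxSum-indicator-≤-image s Bbox (λ j → 2 ^ (b j ∸ a j)) (λ ℓ j → shiftʳ (a j) (ℓ j)) (Admissible z)
             (λ ℓ ℓ∈ j → shiftʳ-< (a j) (b j ∸ a j) (ℓ j)
                            (subst (λ e → ℓ j < 2 ^ e) (sym (ℕ.m+[n∸m]≡n (a≤b j))) (ℓ∈ j)))
             (λ ℓ ℓ′ _ _ → admissible-unique a |a|≤m∸t z ℓ ℓ′))

  admissible-count : ∀ z → admissibleCount z ℚ.≤ ℕ→ℚ (2 ^ (sumFin s b ∸ (m ∸ t)))
  admissible-count z with ℕ.≤-total (sumFin s b) (m ∸ t)
  ... | inj₁ |b|≤m∸t = subst (λ e → admissibleCount z ℚ.≤ ℕ→ℚ (2 ^ e))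
                             (trans (ℕ.n∸n≡0 (sumFin s b)) (sym (ℕ.m≤n⇒m∸n≡0 |b|≤m∸t)))
                             (admissible-count-≤ b (λ _ → ℕ.≤-refl) |b|≤m∸t z)
  ... | inj₂ m∸t≤|b| with ∃-≤-with-sum s b (m ∸ t) m∸t≤|b|
  ...   | a , a≤b , |a|≡m∸t = subst (λ e → admissibleCount z ℚ.≤ ℕ→ℚ (2 ^ (sumFin s b ∸ e))) |a|≡m∸t
                                    (admissible-count-≤ a a≤b (ℕ.≤-reflexive |a|≡m∸t) z)

  doubleSumTrunc-≤-count : ∀ Z (R : (Fin s → ℕ) → Bool) A → 0ℚ ℚ.≤ A →
    (∀ z → admissibleCount z ℚ.≤ A) →
    (∀ z ℓ → InBox s Bbox ℓ → Admissible z ℓ ≡ true → R z ≡ true) →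
    doubleSumTrunc s Cs m b Z
      ℚ.≤ A ℚ.* boxSum s (λ _ → Z) (λ z → indicator (R z) ℚ.* pow2inv (sumFin s z))
  doubleSumTrunc-≤-count Z R A 0≤A count⇒A adm⇒R = begin
    doubleSumTrunc s Cs m b Z
      ≡⟨ boxSum-cong s Bbox (λ ℓ _ → inner-sum ℓ) ⟩
    boxSum s Bbox (λ ℓ → boxSum s Zbox (λ z → indicator (Admissible z ℓ) ℚ.* w z))
      ≡⟨ boxSum-swap s Bbox s Zbox _ ⟩
    boxSum s Zbox (λ z → boxSum s Bbox (λ ℓ → indicator (Admissible z ℓ) ℚ.* w z))
      ≡⟨ boxSum-cong s Zbox (λ z _ → trans (boxSum-cong s Bbox (λ ℓ _ → ℚ.*-comm _ (w z)))
                                             (trans (boxSum-*ˡ s Bbox (w z) _) (ℚ.*-comm (w z) _))) ⟩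
    boxSum s Zbox (λ z → admissibleCount z ℚ.* w z)
      ≤⟨ boxSum-mono s Zbox (λ z _ → 0≤⇒*-monoʳ-≤ (0≤pow2inv (sumFin s z)) (count⇒A·R z)) ⟩
    boxSum s Zbox (λ z → (A ℚ.* indicator (R z)) ℚ.* w z)
      ≡⟨ boxSum-cong s Zbox (λ z _ → ℚ.*-assoc A (indicator (R z)) (w z)) ⟩
    boxSum s Zbox (λ z → A ℚ.* (indicator (R z) ℚ.* w z))
      ≡⟨ boxSum-*ˡ s Zbox A _ ⟩
    A ℚ.* boxSum s Zbox (λ z → indicator (R z) ℚ.* w z) ∎
    where
    open ℚ.≤-Reasoning
    Zbox : Fin s → ℕ
    Zbox _ = Z
    w : (Fin s → ℕ) → ℚ
    w z = pow2inv (sumFin s z)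
    inner-sum : ∀ ℓ →
      (if inBᵇ s b ℓ then boxSumIf s Zbox (λ z → inDual*ᵇ s Cs m (shiftXor s ℓ z)) w else 0ℚ)
        ≡ boxSum s Zbox (λ z → indicator (Admissible z ℓ) ℚ.* w z)
    inner-sum ℓ with inBᵇ s b ℓ
    ... | true  = boxSum-cong s Zbox (λ z _ → if-then-0≡indicator* _ (w z))
    ... | false = sym (boxSum-zero s Zbox (λ z _ → ℚ.*-zeroˡ (w z)))
    count⇒A·R : ∀ z → admissibleCount z ℚ.≤ A ℚ.* indicator (R z)
    count⇒A·R z with R z in e
    ... | true  = subst (admissibleCount z ℚ.≤_) (sym (ℚ.*-identityʳ A)) (count⇒A z)
    ... | false = ℚ.≤-reflexive (trans (boxSum-zero s Bbox (λ ℓ ℓ∈ → cong indicator (not-admissible ℓ ℓ∈)))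
                                       (sym (ℚ.*-zeroʳ A)))
      where
      not-admissible : ∀ ℓ → InBox s Bbox ℓ → Admissible z ℓ ≡ false
      not-admissible ℓ ℓ∈ with Admissible z ℓ in adm
      ... | false = refl
      ... | true  = contradiction (trans (sym (adm⇒R z ℓ ℓ∈ adm)) e) λ ()

  shiftXor-digit : ∀ z ℓ → InBox s Bbox ℓ → Admissible z ℓ ≡ true → ∀ j i →
    bit (shiftXor s ℓ z j) i ≡ true → i < b j ⊎ suc i ≡ z j + b j
  shiftXor-digit z ℓ ℓ∈ adm j i digit with bit (ℓ j) i in ℓ-digit
  ... | false = inj₂ (bit-floor2^pred (z j + b j) i (begin
    bit F i                              ≡⟨ cong (_xor bit F i) ℓ-digit ⟨
    bit (ℓ j) i xor bit F i              ≡⟨ bit-shiftXor z ℓ adm j i ⟨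
    bit (shiftXor s ℓ z j) i             ≡⟨ digit ⟩
    true                                 ∎))
    where
    open ≡-Reasoning
    F = floor2^pred (z j + b j)
  ... | true with i ℕ.<? b j
  ...   | yes i<b = inj₁ i<b
  ...   | no  i≮b = contradiction (trans (sym ℓ-digit) (<2^⇒bit≡false i (ℓ j) ℓ<2^i)) λ ()
    where
    ℓ<2^i : ℓ j < 2 ^ i
    ℓ<2^i = ℕ.<-≤-trans (ℓ∈ j) (ℕ.^-monoʳ-≤ 2 (ℕ.≮⇒≥ i≮b))

  dualWeight-shiftXor : ∀ z ℓ → InBox s Bbox ℓ → Admissible z ℓ ≡ true →
    dualWeight s m (λ j → bit (shiftXor s ℓ z j)) ≤ sumFin s z + 2 * sumFin s b
  dualWeight-shiftXor z ℓ ℓ∈ adm = begin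
    dualWeight s m (λ j → bit (shiftXor s ℓ z j))
      ≤⟨ sumFin-mono s (λ j → topTwo-≤-one-outlier _ (b j) (z j + b j) (support-strictDec (2 * m) _)
                                 (λ i i∈ → shiftXor-digit z ℓ ℓ∈ adm j i (proj₂ (∈-support⁻ (2 * m) _ i i∈)))
                                 (ℕ.m≤n+m (b j) (z j))) ⟩
    sumFin s (λ j → z j + b j + b j)
      ≡⟨ sumFin-cong s (λ j → reorder (z j) (b j)) ⟩
    sumFin s (λ j → z j + 2 * b j)
      ≡⟨ sumFin-+ s z (λ j → 2 * b j) ⟩
    sumFin s z + sumFin s (λ j → 2 * b j)
      ≡⟨ cong (sumFin s z +_) (sumFin-*ˡ s 2 b) ⟩
    sumFin s z + 2 * sumFin s b ∎
    where
    open ℕ.≤-Reasoning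
    reorder : ∀ z b → z + b + b ≡ z + 2 * b
    reorder = ℕ-Solver.solve-∀

  -- When |b| < m a nonzero digit of k = ℓ ⊕ ⌊2^{z+b-1}⌋ either lies below 2m, where the
  -- sequence property makes k heavy, or is the high digit z_j + b_j - 1 itself.
  digit⇒|z|≥ : sumFin s b < m → ∀ z ℓ → InBox s Bbox ℓ → Admissible z ℓ ≡ true → ∀ j₀ i₀ →
    bit (shiftXor s ℓ z j₀) i₀ ≡ true → (2 * m ∸ 2 * sumFin s b) ∸ t ≤ sumFin s z
  digit⇒|z|≥ |b|<m z ℓ ℓ∈ adm j₀ i₀ digit with i₀ ℕ.<? 2 * m
  ... | yes i₀<2m = heavy⇒≤ {m} {sumFin s b} {t} (ℕ.<-≤-trans
          (2m<dualWeight+t seq m (λ j → bit (shiftXor s ℓ z j)) j₀ i₀ i₀<2m digit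
             (inDual⇒dualForm≡false s Cs m (shiftXor s ℓ z)
                (inDual*⇒inDual s Cs m _ (admissible⇒inDual* z ℓ adm))))
          (ℕ.+-monoˡ-≤ t (dualWeight-shiftXor z ℓ ℓ∈ adm)))
  ... | no  i₀≮2m with shiftXor-digit z ℓ ℓ∈ adm j₀ i₀ digit
  ...   | inj₂ 1+i₀≡ = high-digit⇒≤ {m} {sumFin s b} {t}
                         (ℕ.≤-trans (ℕ.≤-trans (ℕ.≮⇒≥ i₀≮2m) (ℕ.n≤1+n i₀)) (ℕ.≤-reflexive 1+i₀≡))
                         (sumFin-≥ s b j₀) (sumFin-≥ s z j₀)
  ...   | inj₁ i₀<b  = contradiction (ℕ.<-≤-trans i₀<b b₀≤2m) (ℕ.≤⇒≯ (ℕ.≮⇒≥ i₀≮2m))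
    where
    b₀≤2m : b j₀ ≤ 2 * m
    b₀≤2m = ℕ.≤-trans (sumFin-≥ s b j₀) (ℕ.≤-trans (ℕ.<⇒≤ |b|<m) (ℕ.m≤n*m m 2))

  admissible⇒|z|≥ : sumFin s b < m → ∀ z ℓ → InBox s Bbox ℓ → Admissible z ℓ ≡ true →
                    (2 * m ∸ 2 * sumFin s b) ∸ t ≤ sumFin s z
  admissible⇒|z|≥ |b|<m z ℓ ℓ∈ adm =
    let (j₀ , k≢0) = inDual*⇒≢0 s Cs m (shiftXor s ℓ z) (admissible⇒inDual* z ℓ adm)
        (i₀ , digit) = ≢0⇒∃bit (shiftXor s ℓ z j₀) k≢0
    in digit⇒|z|≥ |b|<m z ℓ ℓ∈ adm j₀ i₀ digit

doubleSumTrunc-≤-2^ : ∀ {t s Cs} → IsOrder2DigitalSeq t s Cs → ∀ m b → ∀ Z →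
  doubleSumTrunc s Cs m b Z ℚ.≤ ℕ→ℚ (2 ^ t * 2 ^ s) ℚ.* ℕ→ℚ (2 ^ (sumFin s b ∸ m))
doubleSumTrunc-≤-2^ {t} {s} {Cs} seq m b Z = begin
  doubleSumTrunc s Cs m b Z
    ≤⟨ doubleSumTrunc-≤-count seq m b Z (λ _ → true) (ℕ→ℚ (2 ^ e)) (0≤ℕ→ℚ (2 ^ e))
                               (admissible-count seq m b) (λ _ _ _ _ → refl) ⟩
  ℕ→ℚ (2 ^ e) ℚ.* boxSum s (λ _ → Z) (λ z → 1ℚ ℚ.* pow2inv (sumFin s z))
    ≡⟨ cong (ℕ→ℚ (2 ^ e) ℚ.*_) (boxSum-cong s (λ _ → Z) (λ z _ → ℚ.*-identityˡ _)) ⟩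
  ℕ→ℚ (2 ^ e) ℚ.* boxSum s (λ _ → Z) (λ z → pow2inv (sumFin s z))
    ≤⟨ 0≤⇒*-monoˡ-≤ (0≤ℕ→ℚ (2 ^ e)) (boxSum-pow2inv-≤2^ s Z) ⟩
  ℕ→ℚ (2 ^ e) ℚ.* ℕ→ℚ (2 ^ s)
    ≡⟨ ℕ→ℚ-* (2 ^ e) (2 ^ s) ⟨
  ℕ→ℚ (2 ^ e * 2 ^ s)
    ≤⟨ ℕ→ℚ-mono-≤ (ℕ.*-monoˡ-≤ (2 ^ s) (ℕ.^-monoʳ-≤ 2 (excess-≤ (sumFin s b) m t))) ⟩
  ℕ→ℚ (2 ^ (t + (sumFin s b ∸ m)) * 2 ^ s)
    ≡⟨ cong ℕ→ℚ (trans (cong (_* 2 ^ s) (ℕ.^-distribˡ-+-* 2 t (sumFin s b ∸ m)))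
                       (ℕ*.xy∙z≈xz∙y (2 ^ t) (2 ^ (sumFin s b ∸ m)) (2 ^ s))) ⟩
  ℕ→ℚ (2 ^ t * 2 ^ s * 2 ^ (sumFin s b ∸ m))
    ≡⟨ ℕ→ℚ-* (2 ^ t * 2 ^ s) _ ⟩
  ℕ→ℚ (2 ^ t * 2 ^ s) ℚ.* ℕ→ℚ (2 ^ (sumFin s b ∸ m)) ∎
  where
  open ℚ.≤-Reasoning
  e = sumFin s b ∸ (m ∸ t)

doubleSumTrunc-≤-binomial : ∀ {t s′ Cs} → IsOrder2DigitalSeq t (suc s′) Cs →
  ∀ m b → sumFin (suc s′) b < m → ∀ Z →
  doubleSumTrunc (suc s′) Cs m b Z ℚ.≤
    ℕ→ℚ (2 ^ t * (2 ^ t * (2 * 3 ^ s′))) ℚ.* pow2inv (2 * m ∸ 2 * sumFin (suc s′) b)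
      ℚ.* ℕ→ℚ ((2 * m ∸ 2 * sumFin (suc s′) b + suc s′) C s′)
doubleSumTrunc-≤-binomial {t} {s′} {Cs} seq m b |b|<m Z = begin
  doubleSumTrunc s Cs m b Z
    ≤⟨ doubleSumTrunc-≤-count seq m b Z (λ z → n₀ ≤ᵇ sumFin s z) (ℕ→ℚ (2 ^ e)) (0≤ℕ→ℚ (2 ^ e))
                               (admissible-count seq m b)
                   (λ z ℓ ℓ∈ adm → ≤⇒≤ᵇ-true (admissible⇒|z|≥ seq m b |b|<m z ℓ ℓ∈ adm)) ⟩
  ℕ→ℚ (2 ^ e) ℚ.* boxTail s′ Z n₀
    ≤⟨ 0≤⇒*-mono-≤ (0≤ℕ→ℚ (2 ^ e)) 0≤boxTail
                   (ℕ→ℚ-mono-≤ (ℕ.^-monoʳ-≤ 2 (excess-≤-t t |b|<m))) (boxTail≤ s′ Z n₀) ⟩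
  ℕ→ℚ (2 ^ t) ℚ.* (c ℚ.* (pow2inv n₀ ℚ.* ℕ→ℚ ((n₀ + s′) C s′)))
    ≤⟨ 0≤⇒*-monoˡ-≤ (0≤ℕ→ℚ (2 ^ t)) (0≤⇒*-monoˡ-≤ (0≤ℕ→ℚ (2 * 3 ^ s′))
         (0≤⇒*-mono-≤ (0≤pow2inv n₀) (0≤ℕ→ℚ ((n₀ + s′) C s′))
            (pow2inv-≤-2^*pow2inv n₀ t (subst (n ≤_) (ℕ.+-comm t n₀) (ℕ.m≤n+m∸n n t)))
            (ℕ→ℚ-mono-≤ (C-monoˡ-≤ s′ (ℕ.+-mono-≤ (ℕ.m∸n≤m n t) (ℕ.n≤1+n s′)))))) ⟩
  ℕ→ℚ (2 ^ t) ℚ.* (c ℚ.* ((ℕ→ℚ (2 ^ t) ℚ.* pow2inv n) ℚ.* B))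
    ≡⟨ reassociate (ℕ→ℚ (2 ^ t)) c (ℕ→ℚ (2 ^ t)) (pow2inv n) B ⟩
  (ℕ→ℚ (2 ^ t) ℚ.* (ℕ→ℚ (2 ^ t) ℚ.* c)) ℚ.* pow2inv n ℚ.* B
    ≡⟨ cong (λ x → x ℚ.* pow2inv n ℚ.* B)
            (trans (cong (ℕ→ℚ (2 ^ t) ℚ.*_) (sym (ℕ→ℚ-* (2 ^ t) (2 * 3 ^ s′)))) (sym (ℕ→ℚ-* (2 ^ t) _))) ⟩
  ℕ→ℚ (2 ^ t * (2 ^ t * (2 * 3 ^ s′))) ℚ.* pow2inv n ℚ.* B ∎
  where
  open ℚ.≤-Reasoning
  s = suc s′
  e = sumFin s b ∸ (m ∸ t)
  n = 2 * m ∸ 2 * sumFin s b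
  n₀ = n ∸ t
  c = ℕ→ℚ (2 * 3 ^ s′)
  B = ℕ→ℚ ((n + s) C s′)
  0≤boxTail : 0ℚ ℚ.≤ boxTail s′ Z n₀
  0≤boxTail = boxSum-nonNeg s (λ _ → Z) λ z _ →
    0≤* (0≤indicator (n₀ ≤ᵇ sumFin s z)) (0≤pow2inv (sumFin s z))
  reassociate : ∀ x c y p b → x ℚ.* (c ℚ.* ((y ℚ.* p) ℚ.* b)) ≡ (x ℚ.* (y ℚ.* c)) ℚ.* p ℚ.* b
  reassociate = solve-∀ ℚ-ring

lemma6 : (s t : ℕ) → 1 ≤ s →
  Σ ℕ λ K → (0 < K) ×
    ((Cs : GenMats s) → IsOrder2DigitalSeq t s Cs →
     (N r : ℕ) (m : Fin r → ℕ) →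
     (∀ i j → i F.< j → m j < m i) →
     N ≡ sumFin r (λ i → 2 ^ m i) → 2 ≤ N →
     (h : Fin r) (b : Fin s → ℕ) →
     (m h ≤ sumFin s b →
        ∀ Z → doubleSumTrunc s Cs (m h) b Z
                ℚ.≤ ℕ→ℚ K ℚ.* ℕ→ℚ (2 ^ (sumFin s b ∸ m h)))
     ×
     (sumFin s b < m h →
        ∀ Z → doubleSumTrunc s Cs (m h) b Z
                ℚ.≤ ℕ→ℚ K ℚ.* pow2inv (2 * m h ∸ 2 * sumFin s b)
                      ℚ.* ℕ→ℚ ((2 * m h ∸ 2 * sumFin s b + s) C (s ∸ 1))))
lemma6 zero    t ()
lemma6 (suc s′) t _ = K , ℕ.*-mono-≤ 1≤A 1≤A′ , λ Cs seq N r m _ _ _ h b →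
    (λ _ Z → scale A≤K (2 ^ (sumFin (suc s′) b ∸ m h)) (doubleSumTrunc-≤-2^ seq (m h) b Z)) ,
    (λ |b|<m Z → let n = 2 * m h ∸ 2 * sumFin (suc s′) b in
                 scale₂ 2^t*A′≤K n ((n + suc s′) C s′) (doubleSumTrunc-≤-binomial seq (m h) b |b|<m Z))
  where
  A = 2 ^ t * 2 ^ suc s′
  A′ = 2 ^ t * (2 * 3 ^ s′)
  K = A * A′
  1≤A : 1 ≤ A
  1≤A = ℕ.*-mono-≤ (ℕ.m^n>0 2 t) (ℕ.m^n>0 2 (suc s′))
  1≤A′ : 1 ≤ A′
  1≤A′ = ℕ.*-mono-≤ (ℕ.m^n>0 2 t) (ℕ.*-mono-≤ {1} {2} (s≤s z≤n) (ℕ.m^n>0 3 s′))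
  A≤K : A ≤ K
  A≤K = subst (_≤ K) (ℕ.*-identityʳ A) (ℕ.*-monoʳ-≤ A 1≤A′)
  2^t*A′≤K : 2 ^ t * A′ ≤ K
  2^t*A′≤K = ℕ.*-monoˡ-≤ A′ (subst (_≤ A) (ℕ.*-identityʳ (2 ^ t))
                                     (ℕ.*-monoʳ-≤ (2 ^ t) (ℕ.m^n>0 2 (suc s′))))
  scale : ∀ {x a} → a ≤ K → ∀ n → x ℚ.≤ ℕ→ℚ a ℚ.* ℕ→ℚ n → x ℚ.≤ ℕ→ℚ K ℚ.* ℕ→ℚ n
  scale a≤K n x≤ = ℚ.≤-trans x≤ (0≤⇒*-monoʳ-≤ (0≤ℕ→ℚ n) (ℕ→ℚ-mono-≤ a≤K))
  scale₂ : ∀ {x a} → a ≤ K → ∀ d c →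
           x ℚ.≤ ℕ→ℚ a ℚ.* pow2inv d ℚ.* ℕ→ℚ c → x ℚ.≤ ℕ→ℚ K ℚ.* pow2inv d ℚ.* ℕ→ℚ c
  scale₂ a≤K d c x≤ =
    ℚ.≤-trans x≤ (0≤⇒*-monoʳ-≤ (0≤ℕ→ℚ c) (0≤⇒*-monoʳ-≤ (0≤pow2inv d) (ℕ→ℚ-mono-≤ a≤K)))
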